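{- In the setting below, the common bases of $(\vec A_1,\vec A_2)$ are in one-to-one correspondence with the disjoint $S$--$T$ paths of $G$. In addition, if $(S,T)$ is in the LGV position on $G$, then $(\vec A_1,\vec A_2)$ is a Pfaffian pair with constant $\pm1$.
   Context: $G=(V,E)$ is a directed acyclic graph; $S=\{s_1,\dots,s_k\}$, $T=\{t_1,\dots,t_k\}$ are disjoint vertex subsets with $|S|=|T|=k$; every $s_i$ has in-degree $0$ and every $t_j$ has out-degree $0$. A disjoint $S$--$T$ path is a union of $k$ pairwise vertex-disjoint directed paths $P_1,\dots,P_k$ with $P_i$ from $s_i$ to $t_{\sigma_P(i)}$ for a permutation $\sigma_P$; $\operatorname{sgn}P=\operatorname{sgn}\sigma_P$. $(S,T)$ is in the LGV position if $\operatorname{sgn}P$ is the same for all disjoint $S$--$T$ paths. Let $\tilde V=V\setminus(S\cup T)$, $\tilde V_S,\tilde V_T$ disjoint copies of $\tilde V$ ($v_s,v_t$ the copies of $v$; $v_s=v$ for $v\in S$, $v_t=v$ for $v\in T$). $\Gamma$ is bipartite with parts $V_S=S\cup\tilde V_S$, $V_T=T\cup\tilde V_T$ and edges $F=F_1\cup F_2$, $F_1=\{\{u_s,v_t\}:(u,v)\in E\}$, $F_2=\{\{v_s,v_t\}:v\in\tilde V\}$; $\vec\Gamma$ orients $F_1$ from $V_T$ to $V_S$ and $F_2$ from $V_S$ to $V_T$. Order $V_S$ with $s_1,\dots,s_k$ first and $V_T$ with $t_1,\dots,t_k$ first. Let $A_U\in\mathbb{Q}^{V_S\times F}$ and $A_V\in\mathbb{Q}^{V_T\times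 F}$ have entry $1$ at $(x,e)$ if $x\in e$ and $0$ otherwise (rows in these orders, columns in a common fixed order of $F$); let $s_e=+1$ if $e$ is oriented from $V_S$ to $V_T$ and $-1$ otherwise; $\vec A_1=A_U\operatorname{diag}(s_e)_{e\in F}$, $\vec A_2=A_V$. A common base is a column set $B$ with $\vec A_1[B],\vec A_2[B]$ both square nonsingular; the pair is Pfaffian with constant $c\neq0$ if $\det\vec A_1[B]\det\vec A_2[B]=c$ for all common bases. -}

module Defs where

open import Data.Nat as ℕ using (ℕ; zero; suc; _<ᵇ_)
open import Data.Fin as Fin using (Fin; zero; suc; splitAt; punchIn; toℕ)
open import Data.Fin.Permutation using (Permutation′; _⟨$⟩ʳ_)
open import Data.Bool using (Bool; true; false; if_then_else_; _∧_)
open import Data.Sum using (_⊎_; inj₁; inj₂)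
open import Data.Product using (Σ; _×_; _,_; proj₁; proj₂)
open import Data.List as List using (List; []; _∷_; length; lookup)
open import Data.List.Membership.Propositional using (_∈_)
open import Data.List.Relation.Unary.Unique.Propositional using (Unique)
open import Data.Rational using (ℚ; 0ℚ; 1ℚ; -_; _+_; _*_)
open import Data.Empty using (⊥)
open import Relation.Nullary using (¬_; does)
open import Relation.Binary.PropositionalEquality using (_≡_; _≢_)
open import Relation.Binary.Construct.Closure.Transitive using (TransClosure)

Σℚ : (n : ℕ) → (Fin n → ℚ) → ℚ
Σℚ zero    f = 0ℚ
Σℚ (suc n) f = f zero + Σℚ n (λ i → f (suc i))

sgnℕ : ℕ → ℚ
sgnℕ zero    = 1ℚ
sgnℕ (suc n) = - sgnℕ n

det : (n : ℕ) → (Fin n → Fin n → ℚ) → ℚ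
det zero    A = 1ℚ
det (suc n) A =
  Σℚ (suc n) (λ j → sgnℕ (toℕ j) * (A zero j * det n (λ i j′ → A (suc i) (punchIn j j′))))

δ : ∀ {n} → Fin n → Fin n → ℚ
δ i j = if does (i Fin.≟ j) then 1ℚ else 0ℚ

Σℕ : (n : ℕ) → (Fin n → ℕ) → ℕ
Σℕ zero    f = 0
Σℕ (suc n) f = f zero ℕ.+ Σℕ n (λ i → f (suc i))

inversions : (k : ℕ) → (Fin k → Fin k) → ℕ
inversions k σ = Σℕ k (λ i → Σℕ k (λ j →
  if (toℕ i <ᵇ toℕ j) ∧ (toℕ (σ j) <ᵇ toℕ (σ i)) then 1 else 0))

sgn : ∀ {k} → Permutation′ k → ℚ
sgn {k} σ = sgnℕ (inversions k (σ ⟨$⟩ʳ_))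

-- The graph G.  WLOG the vertex set is V = S ⊎ T ⊎ Ṽ, with
-- S = {s_1..s_k}, T = {t_1..t_k}, Ṽ = {v_1..v_m}.

data Vtx (k m : ℕ) : Set where
  src : Fin k → Vtx k m
  snk : Fin k → Vtx k m
  mid : Fin m → Vtx k m

record Graph (k m : ℕ) : Set where
  field
    edges  : List (Vtx k m × Vtx k m)
    unique : Unique edges

open Graph public

Edge : ∀ {k m} → Graph k m → Vtx k m → Vtx k m → Set
Edge G u v = (u , v) ∈ edges G

IsAcyclic : ∀ {k m} → Graph k m → Set
IsAcyclic G = ∀ v → ¬ TransClosure (Edge G) v v

SourcesHaveInDeg0 : ∀ {k m} → Graph k m → Set
SourcesHaveInDeg0 G = ∀ u i → ¬ Edge G u (src i)

SinksHaveOutDeg0 : ∀ {k m} → Graph k m → Set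
SinksHaveOutDeg0 G = ∀ j v → ¬ Edge G (snk j) v

data IsWalk {k m} (G : Graph k m) : Vtx k m → Vtx k m → List (Vtx k m) → Set where
  here : ∀ {u} → IsWalk G u u (u ∷ [])
  step : ∀ {u w v xs} → Edge G u w → IsWalk G w v xs → IsWalk G u v (u ∷ xs)

IsPath : ∀ {k m} (G : Graph k m) → Vtx k m → Vtx k m → List (Vtx k m) → Set
IsPath G u v xs = IsWalk G u v xs × Unique xs

record DisjointPaths {k m} (G : Graph k m) : Set where
  field
    σ        : Permutation′ k
    path     : Fin k → List (Vtx k m)
    isPath   : ∀ i → IsPath G (src i) (snk (σ ⟨$⟩ʳ i)) (path i)
    disjoint : ∀ i j → i ≢ j → ∀ x → x ∈ path i → x ∈ path j → ⊥


open DisjointPaths public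

_≈P_ : ∀ {k m} {G : Graph k m} → DisjointPaths G → DisjointPaths G → Set
P ≈P Q = ∀ i → path P i ≡ path Q i

sgnP : ∀ {k m} {G : Graph k m} → DisjointPaths G → ℚ
sgnP P = sgn (σ P)

LGVPosition : ∀ {k m} → Graph k m → Set
LGVPosition G = ∀ (P Q : DisjointPaths G) → sgnP P ≡ sgnP Q

-- V_S = S ∪ Ṽ_S and V_T = T ∪ Ṽ_T are both indexed by Fin (k + m):
-- index i < k is s_i (resp. t_i), index k + w is the copy (v_w)_s (resp. (v_w)_t).
-- F = F₁ ∪ F₂ is indexed by Fin (|E| + m): index ℓ < |E| is the edge
-- {u_s, v_t} for the ℓ-th edge (u,v) of E, index |E| + w is {(v_w)_s, (v_w)_t}.

-- [ x = u_s ] for x ∈ V_S (given as S ⊎ Ṽ) and u ∈ V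
isS : ∀ {k m} → Fin k ⊎ Fin m → Vtx k m → ℚ
isS (inj₁ i) (src i′) = δ i i′
isS (inj₂ w) (mid w′) = δ w w′
isS _        _        = 0ℚ

-- [ y = v_t ] for y ∈ V_T (given as T ⊎ Ṽ) and v ∈ V
isT : ∀ {k m} → Fin k ⊎ Fin m → Vtx k m → ℚ
isT (inj₁ j) (snk j′) = δ j j′
isT (inj₂ w) (mid w′) = δ w w′
isT _        _        = 0ℚ

|F| : ∀ {k m} → Graph k m → ℕ
|F| {k} {m} G = length (edges G) ℕ.+ m

A-U : ∀ {k m} (G : Graph k m) → Fin (k ℕ.+ m) → Fin (|F| G) → ℚ
A-U {k} G x e with splitAt (length (edges G)) e
... | inj₁ ℓ = isS (splitAt k x) (proj₁ (lookup (edges G) ℓ))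
... | inj₂ w = isS (splitAt k x) (mid w)

A-V : ∀ {k m} (G : Graph k m) → Fin (k ℕ.+ m) → Fin (|F| G) → ℚ
A-V {k} G y e with splitAt (length (edges G)) e
... | inj₁ ℓ = isT (splitAt k y) (proj₂ (lookup (edges G) ℓ))
... | inj₂ w = isT (splitAt k y) (mid w)

-- s_e: F₁ is oriented V_T → V_S (−1), F₂ is oriented V_S → V_T (+1)
sₑ : ∀ {k m} (G : Graph k m) → Fin (|F| G) → ℚ
sₑ G e with splitAt (length (edges G)) e
... | inj₁ _ = - 1ℚ
... | inj₂ _ = 1ℚ

A⃗₁ : ∀ {k m} (G : Graph k m) → Fin (k ℕ.+ m) → Fin (|F| G) → ℚ
A⃗₁ G x e = A-U G x e * sₑ G e

A⃗₂ : ∀ {k m} (G : Graph k m) → Fin (k ℕ.+ m) → Fin (|F| G) → ℚ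
A⃗₂ G = A-V G

-- Since both A⃗₁ and A⃗₂ have k + m rows, A⃗₁[B] and A⃗₂[B] are square iff |B| = k + m.
-- A column set B of size r is encoded by the strictly increasing
-- enumeration b : Fin r → Fin |F| of its elements (in the fixed order of F).

StrictlyIncreasing : ∀ {r N} → (Fin r → Fin N) → Set
StrictlyIncreasing b = ∀ i j → i Fin.< j → b i Fin.< b j

sub : ∀ {r N} → (Fin r → Fin N → ℚ) → (Fin r → Fin N) → Fin r → Fin r → ℚ
sub A b i j = A i (b j)

record CommonBase {k m} (G : Graph k m) : Set where
  field
    cols     : Fin (k ℕ.+ m) → Fin (|F| G)
    strict   : StrictlyIncreasing cols
    nonsing₁ : det (k ℕ.+ m) (sub (A⃗₁ G) cols) ≢ 0ℚ
    nonsing₂ : det (k ℕ.+ m) (sub (A⃗₂ G) cols) ≢ 0ℚ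

open CommonBase public

_≈B_ : ∀ {k m} {G : Graph k m} → CommonBase G → CommonBase G → Set
B ≈B B′ = ∀ i → cols B i ≡ cols B′ i

IsPfaffianPair : ∀ {k m} → Graph k m → ℚ → Set
IsPfaffianPair {k} {m} G c =
  c ≢ 0ℚ × (∀ (B : CommonBase G) →
    det (k ℕ.+ m) (sub (A⃗₁ G) (cols B)) * det (k ℕ.+ m) (sub (A⃗₂ G) (cols B)) ≡ c)

module Submission where

-- Every column of A⃗₁ and of A⃗₂ has exactly one nonzero entry, so A⃗₁[B] and A⃗₂[B] are
-- monomial matrices and B is a common base iff it meets every row of V_S once and every row
-- of V_T once.  Such a B is a successor map on the vertices outside T: u moves to v when the
-- column of the edge (u,v) is in B and stays put when the column {u_s,u_t} is.  Starting at
-- the sources this traces k vertex-disjoint S–T paths, acyclicity forbids closed cycles of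
-- moving vertices, and the columns of B are recovered from the paths, which gives the
-- bijection.  For the signs, det A⃗₁[B] · det A⃗₂[B] = sgn π · ∏ s_e with π the permutation
-- of rows V_S → V_T cut out by B.  Contracting a path edge by edge composes π with a
-- transposition and turns one factor s_e = −1 into +1, so both signs flip; at the end
-- π is σ_P extended by the identity and ∏ s_e = (−1)^k.  Hence the product is (−1)^k sgn σ_P,
-- which is constant in the LGV position.

open import Defs
open import Data.Nat as ℕ using (ℕ; zero; suc; _<ᵇ_; _+_; _≤_; _<_; z≤n; s≤s; _≤?_)
import Data.Nat.Properties as ℕP
open import Data.Nat.Solver using (module +-*-Solver)
open import Data.Fin as Fin using (Fin; zero; suc; punchIn; punchOut; pinch; toℕ; fromℕ<; _↑ˡ_; _↑ʳ_; splitAt; join)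
open import Data.Fin.Properties as FinP
  using (punchInᵢ≢i; punchIn-injective; punchOut-injective; suc-injective; toℕ-injective; toℕ<n; toℕ-fromℕ<;
         toℕ-↑ˡ; toℕ-↑ʳ; splitAt-↑ˡ; splitAt-↑ʳ; join-splitAt; ↑ˡ-injective; ↑ʳ-injective; any?; injective⇒≤; pigeonhole)
open import Data.Fin.Permutation using (Permutation′; permutation; _⟨$⟩ʳ_)
open import Data.Fin.Permutation.Components using (transpose; transpose-inverse)
open import Data.Bool using (Bool; true; false; if_then_else_; _∧_; _∨_; not)
open import Data.Bool.Properties using (∧-zeroʳ)
open import Data.Sum using (_⊎_; inj₁; inj₂; [_,_]′)
open import Data.Product using (Σ; _×_; _,_; proj₁; proj₂; ∃)
open import Data.List as List using (List; []; _∷_; length; lookup)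
open import Data.List.Relation.Unary.Any as Any using (here; there)
open import Data.List.Relation.Unary.Any.Properties using (lookup-index)
open import Data.List.Relation.Unary.All as All using (All; []; _∷_)
open import Data.List.Relation.Unary.AllPairs using ([]; _∷_)
open import Data.List.Membership.Propositional using (_∈_)
open import Data.List.Membership.Propositional.Properties using (∈-lookup)
open import Data.List.Relation.Unary.Unique.Propositional using (Unique)
open import Data.Empty using (⊥; ⊥-elim)
open import Data.Unit using (⊤; tt)
open import Relation.Nullary using (¬_; does; yes; no; Dec)
open import Relation.Nullary.Decidable using (_×-dec_; _→-dec_; ¬?; dec-true; dec-false)
open import Relation.Binary using (tri<; tri≈; tri>)
open import Relation.Binary.PropositionalEquality
open import Relation.Binary.Construct.Closure.Transitive using (TransClosure; [_]; _∷_)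
open import Function using (_∘_; id)
import Data.Vec.Functional as Vector
open import Function.Definitions using (Injective)
open import Data.Rational as ℚ using (ℚ; 0ℚ; 1ℚ; -_; _*_)
import Data.Rational.Properties as ℚP
open import Algebra.Solver.CommutativeMonoid ℚP.*-1-commutativeMonoid using (solve; _⊕_; _⊜_) renaming (id to ι)
open import Algebra.Properties.Ring ℚP.+-*-ring using (-‿involutive; -1*x≈-x)

module ℕ-Solver = +-*-Solver
open ℕ-Solver using (_:+_; _:=_)

-- A total variant of punchOut; its value at j = i is irrelevant.
punchOut′ : ∀ {n} → Fin (suc (suc n)) → Fin (suc (suc n)) → Fin (suc n)
punchOut′ zero zero = zero
punchOut′ zero (suc j) = j
punchOut′ (suc i) j = pinch i j

pinch-punchIn : ∀ {n} (i : Fin (suc n)) (j : Fin (suc n)) → pinch i (punchIn (suc i) j) ≡ j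
pinch-punchIn i zero = refl
pinch-punchIn zero (suc j) = refl
pinch-punchIn {suc n} (suc i) (suc j) = cong suc (pinch-punchIn i j)

punchIn-pinch : ∀ {n} (i : Fin (suc n)) (j : Fin (suc (suc n))) → j ≢ suc i → punchIn (suc i) (pinch i j) ≡ j
punchIn-pinch i zero _ = refl
punchIn-pinch zero (suc zero) j≢1 = ⊥-elim (j≢1 refl)
punchIn-pinch zero (suc (suc j)) _ = refl
punchIn-pinch {suc n} (suc i) (suc j) j≢i = cong suc (punchIn-pinch i j (j≢i ∘ cong suc))

punchIn-punchOut′ : ∀ {n} (i j : Fin (suc (suc n))) → j ≢ i → punchIn i (punchOut′ i j) ≡ j
punchIn-punchOut′ zero zero j≢i = ⊥-elim (j≢i refl)
punchIn-punchOut′ zero (suc j) _ = refl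
punchIn-punchOut′ (suc i) j j≢i = punchIn-pinch i j j≢i

punchIn-<ᵇ : ∀ {n} (i : Fin (suc n)) (x y : Fin n) → (toℕ (punchIn i x) <ᵇ toℕ (punchIn i y)) ≡ (toℕ x <ᵇ toℕ y)
punchIn-<ᵇ zero x y = refl
punchIn-<ᵇ (suc i) zero zero = refl
punchIn-<ᵇ (suc i) zero (suc y) = refl
punchIn-<ᵇ (suc i) (suc x) zero = refl
punchIn-<ᵇ (suc i) (suc x) (suc y) = punchIn-<ᵇ i x y

-- The map Fin n → Fin n induced by f after deleting j from the domain and f j from the codomain.
remove : ∀ {n} → (Fin (suc n) → Fin (suc n)) → Fin (suc n) → Fin n → Fin n
remove {suc n} f j p = punchOut′ (f j) (f (punchIn j p))

punchIn-remove : ∀ {n} (f : Fin (suc n) → Fin (suc n)) → Injective _≡_ _≡_ f → ∀ j p →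
                 f (punchIn j p) ≡ punchIn (f j) (remove f j p)
punchIn-remove {suc n} f inj j p = sym (punchIn-punchOut′ (f j) (f (punchIn j p)) (λ e → punchInᵢ≢i j p (inj e)))

remove-injective : ∀ {n} (f : Fin (suc n) → Fin (suc n)) → Injective _≡_ _≡_ f → ∀ j → Injective _≡_ _≡_ (remove f j)
remove-injective f inj j {p} {q} e =
  punchIn-injective j p q (inj (trans (punchIn-remove f inj j p) (trans (cong (punchIn (f j)) e) (sym (punchIn-remove f inj j q)))))

module BigOp {A : Set} (_∙_ : A → A → A) (ε : A)
  (assoc : ∀ x y z → (x ∙ y) ∙ z ≡ x ∙ (y ∙ z))
  (comm : ∀ x y → x ∙ y ≡ y ∙ x)
  (identityˡ : ∀ x → ε ∙ x ≡ x) where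

  Big : (n : ℕ) → (Fin n → A) → A
  Big zero f = ε
  Big (suc n) f = f zero ∙ Big n (λ i → f (suc i))

  Big-cong : ∀ n {f g : Fin n → A} → (∀ i → f i ≡ g i) → Big n f ≡ Big n g
  Big-cong zero eq = refl
  Big-cong (suc n) eq = cong₂ _∙_ (eq zero) (Big-cong n (λ i → eq (suc i)))

  private
    swap-left : ∀ x y z → x ∙ (y ∙ z) ≡ y ∙ (x ∙ z)
    swap-left x y z = trans (sym (assoc x y z)) (trans (cong (_∙ z) (comm x y)) (assoc y x z))

    interchange : ∀ a b c d → (a ∙ b) ∙ (c ∙ d) ≡ (a ∙ c) ∙ (b ∙ d)
    interchange a b c d = trans (assoc a b (c ∙ d)) (trans (cong (a ∙_) (swap-left b c d)) (sym (assoc a c (b ∙ d))))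

    swap-outer : ∀ a x b → (a ∙ x) ∙ b ≡ (b ∙ x) ∙ a
    swap-outer a x b = trans (assoc a x b) (trans (cong (a ∙_) (comm x b)) (trans (sym (assoc a b x))
      (trans (cong (_∙ x) (comm a b)) (trans (assoc b a x) (trans (cong (b ∙_) (comm a x)) (sym (assoc b x a)))))))

  Big-punchIn : ∀ n (f : Fin (suc n) → A) j → Big (suc n) f ≡ f j ∙ Big n (λ i → f (punchIn j i))
  Big-punchIn n f zero = refl
  Big-punchIn (suc n) f (suc j) =
    trans (cong (f zero ∙_) (Big-punchIn n (λ i → f (suc i)) j)) (swap-left _ _ _)

  Big-ε : ∀ n {f : Fin n → A} → (∀ i → f i ≡ ε) → Big n f ≡ ε
  Big-ε zero eq = refl
  Big-ε (suc n) eq = trans (cong₂ _∙_ (eq zero) (Big-ε n (λ i → eq (suc i)))) (identityˡ ε)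

  Big-∙ : ∀ n (f g : Fin n → A) → Big n (λ i → f i ∙ g i) ≡ Big n f ∙ Big n g
  Big-∙ zero f g = sym (identityˡ ε)
  Big-∙ (suc n) f g = trans (cong ((f zero ∙ g zero) ∙_) (Big-∙ n (λ i → f (suc i)) (λ i → g (suc i))))
                            (interchange _ _ _ _)

  Big-reindex : ∀ n (f : Fin n → A) (g : Fin n → Fin n) → Injective _≡_ _≡_ g → Big n (λ i → f (g i)) ≡ Big n f
  Big-reindex zero f g inj = refl
  Big-reindex (suc n) f g inj =
    trans (cong (f (g zero) ∙_)
             (trans (Big-cong n (λ q → cong f (punchIn-remove g inj zero q)))
                    (Big-reindex n (λ y → f (punchIn (g zero) y)) (remove g zero) (remove-injective g inj zero))))
          (sym (Big-punchIn n f (g zero)))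

  Big-↑ : ∀ a b (f : Fin (a + b) → A) → Big (a + b) f ≡ Big a (λ i → f (i ↑ˡ b)) ∙ Big b (λ w → f (a ↑ʳ w))
  Big-↑ zero b f = sym (identityˡ _)
  Big-↑ (suc a) b f = trans (cong (f zero ∙_) (Big-↑ a b (λ i → f (suc i)))) (sym (assoc _ _ _))

  Big-exchange : ∀ {n} (f g : Fin n → A) j → (∀ i → i ≢ j → f i ≡ g i) → Big n f ∙ g j ≡ Big n g ∙ f j
  Big-exchange {suc n} f g j eq =
    trans (cong (_∙ g j) (Big-punchIn n f j))
     (trans (cong (λ z → (f j ∙ z) ∙ g j) (Big-cong n (λ i → eq (punchIn j i) (punchInᵢ≢i j i))))
      (trans (swap-outer _ _ _) (cong (_∙ f j) (sym (Big-punchIn n g j)))))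

module SumNat = BigOp ℕ._+_ 0 ℕP.+-assoc ℕP.+-comm ℕP.+-identityˡ
open SumNat public using () renaming
  (Big to Σn; Big-cong to Σn-cong; Big-punchIn to Σn-punchIn; Big-ε to Σn-0; Big-∙ to Σn-+;
   Big-reindex to Σn-reindex; Big-↑ to Σn-↑; Big-exchange to Σn-exchange)

module ProdRat = BigOp _*_ 1ℚ ℚP.*-assoc ℚP.*-comm ℚP.*-identityˡ
open ProdRat public using () renaming
  (Big to Πq; Big-cong to Πq-cong; Big-punchIn to Πq-punchIn; Big-reindex to Πq-reindex; Big-↑ to Πq-↑;
   Big-exchange to Πq-exchange)

module SumRat = BigOp ℚ._+_ 0ℚ ℚP.+-assoc ℚP.+-comm ℚP.+-identityˡ

Σℕ≡Σn : ∀ n f → Σℕ n f ≡ Σn n f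
Σℕ≡Σn zero f = refl
Σℕ≡Σn (suc n) f = cong (f zero +_) (Σℕ≡Σn n (λ i → f (suc i)))

Σℚ≡Big : ∀ n f → Σℚ n f ≡ SumRat.Big n f
Σℚ≡Big zero f = refl
Σℚ≡Big (suc n) f = cong (f zero ℚ.+_) (Σℚ≡Big n (λ i → f (suc i)))

-- Signs of self-maps of Fin n

ind : Bool → ℕ
ind b = if b then 1 else 0

isInversion : ∀ {n} → (Fin n → Fin n) → Fin n → Fin n → ℕ
isInversion f a b = ind ((toℕ a <ᵇ toℕ b) ∧ (toℕ (f b) <ᵇ toℕ (f a)))

#inversions : ∀ n → (Fin n → Fin n) → ℕ
#inversions n f = Σn n (λ a → Σn n (λ b → isInversion f a b))

inversions≡#inversions : ∀ n f → inversions n f ≡ #inversions n f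
inversions≡#inversions n f = trans (Σℕ≡Σn n _) (Σn-cong n (λ a → Σℕ≡Σn n _))

count-punchIn< : ∀ n (j : Fin (suc n)) → Σn n (λ q → ind (toℕ (punchIn j q) <ᵇ toℕ j)) ≡ toℕ j
count-punchIn< n zero = Σn-0 n (λ q → refl)
count-punchIn< (suc n) (suc j) = cong suc (count-punchIn< n j)

<ᵇ-irrefl : ∀ a → (a <ᵇ a) ≡ false
<ᵇ-irrefl zero = refl
<ᵇ-irrefl (suc a) = <ᵇ-irrefl a

<ᵇ-flip : ∀ a b → a ≢ b → (b <ᵇ a) ≡ not (a <ᵇ b)
<ᵇ-flip zero zero ne = ⊥-elim (ne refl)
<ᵇ-flip zero (suc b) ne = refl
<ᵇ-flip (suc a) zero ne = refl
<ᵇ-flip (suc a) (suc b) ne = <ᵇ-flip a b (λ e → ne (cong suc e))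

<ᵇ-asym : ∀ a b → ((a <ᵇ b) ∧ (b <ᵇ a)) ≡ false
<ᵇ-asym zero zero = refl
<ᵇ-asym zero (suc b) = refl
<ᵇ-asym (suc a) zero = refl
<ᵇ-asym (suc a) (suc b) = <ᵇ-asym a b

split∧ : ∀ b c → ind (not b ∧ c) + ind (b ∧ c) ≡ ind (c)
split∧ true true = refl
split∧ true false = refl
split∧ false true = refl
split∧ false false = refl

split∧′ : ∀ b c → ind (b ∧ not c) + ind (b ∧ c) ≡ ind (b)
split∧′ true true = refl
split∧′ true false = refl
split∧′ false true = refl
split∧′ false false = refl

-- With X the number of q below j both in position and in value, the inversions involving j
-- number (f j − X) + (j − X).
#inversions-remove : ∀ n (f : Fin (suc n) → Fin (suc n)) → Injective _≡_ _≡_ f → ∀ j →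
  Σ ℕ λ X → #inversions (suc n) f + (X + X) ≡ (toℕ (f j) + toℕ j) + #inversions n (remove f j)
#inversions-remove n f inj j = X , main
  where
  c = f j
  g = remove f j
  L : Fin n → Bool
  L q = toℕ (punchIn j q) <ᵇ toℕ j
  M : Fin n → Bool
  M q = toℕ (punchIn c (g q)) <ᵇ toℕ c
  X = Σn n (λ q → ind (L q ∧ M q))
  A = Σn n (λ q → ind (not (L q) ∧ M q))
  B = Σn n (λ q → ind (L q ∧ not (M q)))
  R = #inversions n g
  f-punchIn : ∀ q → f (punchIn j q) ≡ punchIn c (g q)
  f-punchIn q = punchIn-remove f inj j q
  Row : Fin (suc n) → ℕ
  Row a = Σn (suc n) (λ b → isInversion f a b)
  row-j : Row j ≡ A
  row-j = trans (Σn-punchIn n (λ b → isInversion f j b) j) (trans (cong₂ _+_ eq0 refl) (Σn-cong n λ q → eqA q))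
    where
    eq0 : isInversion f j j ≡ 0
    eq0 rewrite <ᵇ-irrefl (toℕ j) = refl
    eqA : ∀ q → isInversion f j (punchIn j q) ≡ ind (not (L q) ∧ M q)
    eqA q rewrite f-punchIn q
                | <ᵇ-flip (toℕ (punchIn j q)) (toℕ j) (λ e → punchInᵢ≢i j q (toℕ-injective e)) = refl
  row-punchIn : ∀ p → Row (punchIn j p) ≡ ind (L p ∧ not (M p)) + Σn n (λ q → isInversion g p q)
  row-punchIn p = trans (Σn-punchIn n (λ b → isInversion f (punchIn j p) b) j) (cong₂ _+_ eqB (Σn-cong n eqR))
    where
    eqB : isInversion f (punchIn j p) j ≡ ind (L p ∧ not (M p))
    eqB rewrite f-punchIn p = cong (λ z → ind (L p ∧ z)) (<ᵇ-flip (toℕ (punchIn c (g p))) (toℕ c) (λ e → punchInᵢ≢i c (g p) (toℕ-injective e)))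
    eqR : ∀ q → isInversion f (punchIn j p) (punchIn j q) ≡ isInversion g p q
    eqR q rewrite f-punchIn p | f-punchIn q | punchIn-<ᵇ j p q | punchIn-<ᵇ c (g q) (g p) = refl
  total : #inversions (suc n) f ≡ A + (B + R)
  total = trans (Σn-punchIn n Row j) (cong₂ _+_ row-j
            (trans (Σn-cong n row-punchIn) (Σn-+ n _ _)))
  AX : A + X ≡ toℕ c
  AX = trans (sym (Σn-+ n _ _)) (trans (Σn-cong n (λ q → split∧ (L q) (M q)))
         (trans (Σn-reindex n (λ y → ind (toℕ (punchIn c y) <ᵇ toℕ c)) g (remove-injective f inj j)) (count-punchIn< n c)))
  BX : B + X ≡ toℕ j
  BX = trans (sym (Σn-+ n _ _)) (trans (Σn-cong n (λ q → split∧′ (L q) (M q))) (count-punchIn< n j))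
  main : #inversions (suc n) f + (X + X) ≡ (toℕ c + toℕ j) + R
  main = begin
      #inversions (suc n) f + (X + X) ≡⟨ cong (_+ (X + X)) total ⟩
      A + (B + R) + (X + X) ≡⟨ regroup ⟩
      (A + X) + (B + X) + R ≡⟨ cong₂ (λ u v → u + v + R) AX BX ⟩
      (toℕ c + toℕ j) + R ∎
    where
    open ≡-Reasoning
    regroup : A + (B + R) + (X + X) ≡ (A + X) + (B + X) + R
    regroup = ℕ-Solver.solve 4 (λ a b r x → a :+ (b :+ r) :+ (x :+ x) := (a :+ x) :+ (b :+ x) :+ r) refl A B R X

sgnℕ-+ : ∀ a b → sgnℕ (a + b) ≡ sgnℕ a * sgnℕ b
sgnℕ-+ zero b = sym (ℚP.*-identityˡ _)
sgnℕ-+ (suc a) b = trans (cong -_ (sgnℕ-+ a b)) (ℚP.neg-distribˡ-* (sgnℕ a) (sgnℕ b))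

sgnℕ-sq : ∀ a → sgnℕ a * sgnℕ a ≡ 1ℚ
sgnℕ-sq zero = refl
sgnℕ-sq (suc a) = trans (sym (ℚP.neg-distribˡ-* (sgnℕ a) (- sgnℕ a))) (trans (cong -_ (sym (ℚP.neg-distribʳ-* (sgnℕ a) (sgnℕ a))))
                   (trans (-‿involutive (sgnℕ a * sgnℕ a)) (sgnℕ-sq a)))

sgnF : (n : ℕ) → (Fin n → Fin n) → ℚ
sgnF n f = sgnℕ (inversions n f)

sgnF≡#inversions : ∀ n f → sgnF n f ≡ sgnℕ (#inversions n f)
sgnF≡#inversions n f = cong sgnℕ (inversions≡#inversions n f)

sgnF-remove : ∀ n (f : Fin (suc n) → Fin (suc n)) → Injective _≡_ _≡_ f → ∀ j →
  sgnF (suc n) f ≡ (sgnℕ (toℕ (f j)) * sgnℕ (toℕ j)) * sgnF n (remove f j)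
sgnF-remove n f inj j with #inversions-remove n f inj j
... | X , eq = begin
   sgnF (suc n) f ≡⟨ sgnF≡#inversions (suc n) f ⟩
   sgnℕ I ≡⟨ sym (ℚP.*-identityʳ (sgnℕ I)) ⟩
   sgnℕ I * 1ℚ ≡⟨ cong (sgnℕ I *_) (sym (sgnℕ-sq X)) ⟩
   sgnℕ I * (sgnℕ X * sgnℕ X) ≡⟨ cong (sgnℕ I *_) (sym (sgnℕ-+ X X)) ⟩
   sgnℕ I * sgnℕ (X + X) ≡⟨ sym (sgnℕ-+ I (X + X)) ⟩
   sgnℕ (I + (X + X)) ≡⟨ cong sgnℕ eq ⟩
   sgnℕ ((toℕ (f j) + toℕ j) + #inversions n (remove f j)) ≡⟨ sgnℕ-+ (toℕ (f j) + toℕ j) (#inversions n (remove f j)) ⟩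
   sgnℕ (toℕ (f j) + toℕ j) * sgnℕ (#inversions n (remove f j)) ≡⟨ cong₂ _*_ (sgnℕ-+ (toℕ (f j)) (toℕ j)) (sym (sgnF≡#inversions n (remove f j))) ⟩
   (sgnℕ (toℕ (f j)) * sgnℕ (toℕ j)) * sgnF n (remove f j) ∎
  where
  open ≡-Reasoning
  I = #inversions (suc n) f

isInversion-cong : ∀ {n} {f g : Fin n → Fin n} → (∀ x → f x ≡ g x) → ∀ a b → isInversion f a b ≡ isInversion g a b
isInversion-cong eq a b rewrite eq a | eq b = refl

sgnF-cong : ∀ n {f g : Fin n → Fin n} → (∀ x → f x ≡ g x) → sgnF n f ≡ sgnF n g
sgnF-cong n {f} {g} eq =
  trans (sgnF≡#inversions n f)
        (trans (cong sgnℕ (Σn-cong n (λ a → Σn-cong n (λ b → isInversion-cong eq a b)))) (sym (sgnF≡#inversions n g)))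

sgnF-id : ∀ n → sgnF n id ≡ 1ℚ
sgnF-id n = trans (sgnF≡#inversions n id) (cong sgnℕ (Σn-0 n (λ a → Σn-0 n (λ b → cong ind (<ᵇ-asym (toℕ a) (toℕ b))))))

∘-injective : ∀ {n} {f g : Fin n → Fin n} → Injective _≡_ _≡_ f → Injective _≡_ _≡_ g → Injective _≡_ _≡_ (λ x → f (g x))
∘-injective fi gi e = gi (fi e)

sgnF-comp : ∀ n (f g : Fin n → Fin n) → Injective _≡_ _≡_ f → Injective _≡_ _≡_ g →
            sgnF n (λ x → f (g x)) ≡ sgnF n f * sgnF n g
sgnF-comp zero f g fi gi = refl
sgnF-comp (suc n) f g fi gi = begin
  sgnF (suc n) fg ≡⟨ sgnF-remove n fg (∘-injective fi gi) zero ⟩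
  (a * 1ℚ) * sgnF n (remove fg zero) ≡⟨ cong ((a * 1ℚ) *_) (sgnF-cong n remeq) ⟩
  (a * 1ℚ) * sgnF n (λ q → remove f (g zero) (remove g zero q)) ≡⟨ cong ((a * 1ℚ) *_) (sgnF-comp n _ _ (remove-injective f fi (g zero)) (remove-injective g gi zero)) ⟩
  (a * 1ℚ) * (rf * rg) ≡⟨ trans (sym (ℚP.*-identityʳ _)) (cong (λ z → (a * 1ℚ) * (rf * rg) * z) (sym (sgnℕ-sq (toℕ (g zero))))) ⟩
  (a * 1ℚ) * (rf * rg) * (b * b) ≡⟨ solve 5 (λ A O RF RG B → ((A ⊕ O) ⊕ (RF ⊕ RG)) ⊕ (B ⊕ B) ⊜ ((A ⊕ B) ⊕ RF) ⊕ ((B ⊕ O) ⊕ RG)) refl a 1ℚ rf rg b ⟩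
  ((a * b) * rf) * ((b * 1ℚ) * rg) ≡⟨ cong₂ _*_ (sym (sgnF-remove n f fi (g zero))) (sym (sgnF-remove n g gi zero)) ⟩
  sgnF (suc n) f * sgnF (suc n) g ∎
  where
  open ≡-Reasoning
  fg = λ x → f (g x)
  a = sgnℕ (toℕ (f (g zero)))
  b = sgnℕ (toℕ (g zero))
  rf = sgnF n (remove f (g zero))
  rg = sgnF n (remove g zero)
  remeq : ∀ q → remove fg zero q ≡ remove f (g zero) (remove g zero q)
  remeq q = punchIn-injective (f (g zero)) _ _
     (trans (sym (punchIn-remove fg (∘-injective fi gi) zero q))
       (trans (cong f (punchIn-remove g gi zero q)) (punchIn-remove f fi (g zero) (remove g zero q))))

transpose-first : ∀ {n} (a b : Fin n) → transpose a b a ≡ b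
transpose-first a b with a Fin.≟ a
... | yes _ = refl
... | no a≢a = ⊥-elim (a≢a refl)

transpose-second : ∀ {n} (a b : Fin n) → transpose a b b ≡ a
transpose-second a b with b Fin.≟ a
... | yes b≡a = b≡a
... | no _ with b Fin.≟ b
...   | yes _ = refl
...   | no b≢b = ⊥-elim (b≢b refl)

transpose-other : ∀ {n} (a b x : Fin n) → x ≢ a → x ≢ b → transpose a b x ≡ x
transpose-other a b x x≢a x≢b with x Fin.≟ a
... | yes x≡a = ⊥-elim (x≢a x≡a)
... | no _ with x Fin.≟ b
...   | yes x≡b = ⊥-elim (x≢b x≡b)
...   | no _ = refl

transpose-comm : ∀ {n} (a b x : Fin n) → transpose a b x ≡ transpose b a x
transpose-comm a b x = helper (x Fin.≟ a) (x Fin.≟ b)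
  where
  helper : Relation.Nullary.Dec (x ≡ a) → Relation.Nullary.Dec (x ≡ b) → transpose a b x ≡ transpose b a x
  helper (yes refl) _ = trans (transpose-first x b) (sym (transpose-second b x))
  helper (no na) (yes refl) = trans (transpose-second a x) (sym (transpose-first x a))
  helper (no na) (no nb) = trans (transpose-other a b x na nb) (sym (transpose-other b a x nb na))

transpose-involutive : ∀ {n} (a b x : Fin n) → transpose a b (transpose a b x) ≡ x
transpose-involutive a b x = trans (cong (transpose a b) (transpose-comm a b x)) (transpose-inverse a b)

transpose-injective : ∀ {n} (a b : Fin n) → Injective _≡_ _≡_ (transpose a b)
transpose-injective a b {x} {y} e = trans (sym (transpose-involutive a b x)) (trans (cong (transpose a b) e) (transpose-involutive a b y))

transpose-suc : ∀ {n} (a b q : Fin n) → transpose (suc a) (suc b) (suc q) ≡ suc (transpose a b q)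
transpose-suc a b q with q Fin.≟ a
... | yes _ = refl
... | no _ with q Fin.≟ b
...   | yes _ = refl
...   | no _ = refl

punchOut′-pinch : ∀ {n} (b : Fin (suc (suc n))) (q : Fin (suc n)) → punchOut′ zero (pinch b (suc (punchIn b q))) ≡ q
punchOut′-pinch zero q = refl
punchOut′-pinch (suc b) q = pinch-punchIn b q

-- Removing 0 from transpose 0 (b+1) leaves a cycle c with c b = 0; removing b from c leaves the identity.
sgnF-transpose-zero : ∀ n (b : Fin (suc n)) → sgnF (suc (suc n)) (transpose zero (suc b)) ≡ - 1ℚ
sgnF-transpose-zero zero zero = refl
sgnF-transpose-zero (suc n) b = begin
  sgnF (suc (suc (suc n))) f                           ≡⟨ sgnF-remove (suc (suc n)) f f-injective zero ⟩
  (- s * 1ℚ) * sgnF (suc (suc n)) c                    ≡⟨ cong ((- s * 1ℚ) *_) (sgnF-remove (suc n) c c-injective b) ⟩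
  (- s * 1ℚ) * ((sgnℕ (toℕ (c b)) * s) * sgnF (suc n) (remove c b))
    ≡⟨ cong₂ (λ z w → (- s * 1ℚ) * ((sgnℕ (toℕ z) * s) * w)) cb≡0 (trans (sgnF-cong (suc n) remove-c) (sgnF-id (suc n))) ⟩
  (- s * 1ℚ) * ((1ℚ * s) * 1ℚ)                         ≡⟨ solve 2 (λ S T → (S ⊕ ι) ⊕ ((ι ⊕ T) ⊕ ι) ⊜ S ⊕ T) refl (- s) s ⟩
  (- s) * s                                            ≡⟨ sym (ℚP.neg-distribˡ-* s s) ⟩
  - (s * s)                                            ≡⟨ cong -_ (sgnℕ-sq (toℕ b)) ⟩
  - 1ℚ                                                 ∎
  where
  open ≡-Reasoning
  s = sgnℕ (toℕ b)
  f = transpose {suc (suc (suc n))} zero (suc b)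
  f-injective = transpose-injective zero (suc b)
  c = remove f zero
  c-injective = remove-injective f f-injective zero
  cb≡0 : c b ≡ zero
  cb≡0 = cong (pinch b) (transpose-second zero (suc b))
  remove-c : ∀ q → remove c b q ≡ q
  remove-c q = begin
    punchOut′ (c b) (pinch b (f (suc (punchIn b q))))    ≡⟨ cong (λ z → punchOut′ (c b) (pinch b z)) f-fixes ⟩
    punchOut′ (c b) (pinch b (suc (punchIn b q)))        ≡⟨ cong (λ z → punchOut′ z (pinch b (suc (punchIn b q)))) cb≡0 ⟩
    punchOut′ zero (pinch b (suc (punchIn b q)))         ≡⟨ punchOut′-pinch b q ⟩
    q                                                    ∎
    where
    f-fixes : f (suc (punchIn b q)) ≡ suc (punchIn b q)
    f-fixes = transpose-other zero (suc b) (suc (punchIn b q)) (λ ()) (punchInᵢ≢i b q ∘ suc-injective)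

sgnF-transpose-< : ∀ n (a b : Fin n) → toℕ a < toℕ b → sgnF n (transpose a b) ≡ - 1ℚ
sgnF-transpose-< (suc zero) zero zero ()
sgnF-transpose-< (suc (suc n)) zero (suc b) lt = sgnF-transpose-zero n b
sgnF-transpose-< (suc (suc n)) (suc a) (suc b) (s≤s lt) = begin
  sgnF (suc (suc n)) f ≡⟨ sgnF-remove (suc n) f (transpose-injective (suc a) (suc b)) zero ⟩
  (1ℚ * 1ℚ) * sgnF (suc n) (remove f zero) ≡⟨ cong ((1ℚ * 1ℚ) *_) (trans (sgnF-cong (suc n) req) (sgnF-transpose-< (suc n) a b lt)) ⟩
  (1ℚ * 1ℚ) * (- 1ℚ) ≡⟨ refl ⟩
  - 1ℚ ∎
  where
  open ≡-Reasoning
  f = transpose (suc a) (suc b)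
  req : ∀ q → remove f zero q ≡ transpose a b q
  req q = cong (punchOut′ zero) (transpose-suc a b q)

sgnF-transpose : ∀ n (a b : Fin n) → a ≢ b → sgnF n (transpose a b) ≡ - 1ℚ
sgnF-transpose n a b ne with ℕP.<-cmp (toℕ a) (toℕ b)
... | tri< lt _ _ = sgnF-transpose-< n a b lt
... | tri≈ _ e _ = ⊥-elim (ne (toℕ-injective e))
... | tri> _ _ gt = trans (sgnF-cong n (transpose-comm a b)) (sgnF-transpose-< n b a gt)

injective⇒surjective : ∀ n (f : Fin n → Fin n) → Injective _≡_ _≡_ f → ∀ y → ∃ λ x → f x ≡ y
injective⇒surjective n f inj y with any? (λ x → f x Fin.≟ y)
... | yes r = r
injective⇒surjective (suc n) f inj y | no ¬r = ⊥-elim (ℕP.<-irrefl refl (injective⇒≤ {f = h} hinj))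
  where
  h : Fin (suc n) → Fin n
  h x = punchOut {i = y} {j = f x} (λ e → ¬r (x , sym e))
  hinj : ∀ {a b} → h a ≡ h b → a ≡ b
  hinj {a} {b} e = inj (punchOut-injective {i = y} {j = f a} {k = f b} (λ e′ → ¬r (a , sym e′)) (λ e′ → ¬r (b , sym e′)) e)

module SelfMapInverse (n : ℕ) (f : Fin n → Fin n) (inj : Injective _≡_ _≡_ f) where
  sec : Fin n → Fin n
  sec y = proj₁ (injective⇒surjective n f inj y)
  f-sec : ∀ y → f (sec y) ≡ y
  f-sec y = proj₂ (injective⇒surjective n f inj y)
  sec-f : ∀ x → sec (f x) ≡ x
  sec-f x = inj (f-sec (f x))
  sec-inj : Injective _≡_ _≡_ sec
  sec-inj {a} {b} e = trans (sym (f-sec a)) (trans (cong f e) (f-sec b))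

extendById : ∀ k m → (Fin k → Fin k) → Fin (k + m) → Fin (k + m)
extendById k m σ x with splitAt k x
... | inj₁ i = σ i ↑ˡ m
... | inj₂ w = k ↑ʳ w

extendById-↑ˡ : ∀ k m σ i → extendById k m σ (i ↑ˡ m) ≡ σ i ↑ˡ m
extendById-↑ˡ k m σ i rewrite splitAt-↑ˡ k i m = refl

extendById-↑ʳ : ∀ k m σ w → extendById k m σ (k ↑ʳ w) ≡ k ↑ʳ w
extendById-↑ʳ k m σ w rewrite splitAt-↑ʳ k m w = refl

≤⇒<ᵇ-false : ∀ {a b} → a ≤ b → (b <ᵇ a) ≡ false
≤⇒<ᵇ-false {zero} {b} z≤n = refl
≤⇒<ᵇ-false {suc a} {suc b} (s≤s le) = ≤⇒<ᵇ-false le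

toℕ↑ˡ≤toℕ↑ʳ : ∀ k m (i : Fin k) (w : Fin m) → toℕ i ≤ k + toℕ w
toℕ↑ˡ≤toℕ↑ʳ k m i w = ℕP.≤-trans (ℕP.<⇒≤ (toℕ<n i)) (ℕP.m≤m+n k (toℕ w))

#inversions-extendById : ∀ k m σ → #inversions (k + m) (extendById k m σ) ≡ #inversions k σ
#inversions-extendById k m σ = begin
  #inversions (k + m) E ≡⟨ Σn-↑ k m (λ a → R a) ⟩
  Σn k (λ i → R (i ↑ˡ m)) + Σn m (λ w → R (k ↑ʳ w)) ≡⟨ cong₂ _+_ (Σn-cong k Rl) (Σn-0 m Rr) ⟩
  Σn k (λ i → Σn k (λ i′ → isInversion σ i i′) + 0) + 0 ≡⟨ ℕP.+-identityʳ _ ⟩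
  Σn k (λ i → Σn k (λ i′ → isInversion σ i i′) + 0) ≡⟨ Σn-cong k (λ i → ℕP.+-identityʳ _) ⟩
  #inversions k σ ∎
  where
  open ≡-Reasoning
  E = extendById k m σ
  R : Fin (k + m) → ℕ
  R a = Σn (k + m) (λ b → isInversion E a b)
  Rl : ∀ i → R (i ↑ˡ m) ≡ Σn k (λ i′ → isInversion σ i i′) + 0
  Rl i = trans (Σn-↑ k m (λ b → isInversion E (i ↑ˡ m) b)) (cong₂ _+_ (Σn-cong k e1) (Σn-0 m e2))
    where
    e1 : ∀ i′ → isInversion E (i ↑ˡ m) (i′ ↑ˡ m) ≡ isInversion σ i i′
    e1 i′ rewrite extendById-↑ˡ k m σ i | extendById-↑ˡ k m σ i′ | toℕ-↑ˡ i m | toℕ-↑ˡ i′ m | toℕ-↑ˡ (σ i) m | toℕ-↑ˡ (σ i′) m = refl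
    e2 : ∀ w → isInversion E (i ↑ˡ m) (k ↑ʳ w) ≡ 0
    e2 w rewrite extendById-↑ˡ k m σ i | extendById-↑ʳ k m σ w | toℕ-↑ˡ (σ i) m | toℕ-↑ʳ k w
               | ≤⇒<ᵇ-false (toℕ↑ˡ≤toℕ↑ʳ k m (σ i) w) | ∧-zeroʳ (toℕ (i ↑ˡ m) <ᵇ (k + toℕ w)) = refl
  Rr : ∀ w → R (k ↑ʳ w) ≡ 0
  Rr w = trans (Σn-↑ k m (λ b → isInversion E (k ↑ʳ w) b)) (cong₂ _+_ (Σn-0 k e1) (Σn-0 m e2))
    where
    e1 : ∀ i′ → isInversion E (k ↑ʳ w) (i′ ↑ˡ m) ≡ 0
    e1 i′ rewrite toℕ-↑ʳ k w | toℕ-↑ˡ i′ m | ≤⇒<ᵇ-false (toℕ↑ˡ≤toℕ↑ʳ k m i′ w) = refl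
    e2 : ∀ w′ → isInversion E (k ↑ʳ w) (k ↑ʳ w′) ≡ 0
    e2 w′ rewrite extendById-↑ʳ k m σ w | extendById-↑ʳ k m σ w′ | toℕ-↑ʳ k w | toℕ-↑ʳ k w′ = cong ind (<ᵇ-asym (k + toℕ w) (k + toℕ w′))

sgnF-extendById : ∀ k m σ → sgnF (k + m) (extendById k m σ) ≡ sgnF k σ
sgnF-extendById k m σ = trans (sgnF≡#inversions (k + m) (extendById k m σ)) (trans (cong sgnℕ (#inversions-extendById k m σ)) (sym (sgnF≡#inversions k σ)))

Πq-neg1 : ∀ k → Πq k (λ _ → - 1ℚ) ≡ sgnℕ k
Πq-neg1 zero = refl
Πq-neg1 (suc k) = trans (cong (- 1ℚ *_) (Πq-neg1 k)) (trans (sym (ℚP.neg-distribˡ-* 1ℚ (sgnℕ k))) (cong -_ (ℚP.*-identityˡ (sgnℕ k))))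

Πq-1 : ∀ m → Πq m (λ _ → 1ℚ) ≡ 1ℚ
Πq-1 zero = refl
Πq-1 (suc m) = trans (ℚP.*-identityˡ _) (Πq-1 m)

<⇒<ᵇ-true : ∀ {a b} → a < b → (a <ᵇ b) ≡ true
<⇒<ᵇ-true {zero} {suc b} (s≤s _) = refl
<⇒<ᵇ-true {suc a} {suc b} (s≤s lt) = <⇒<ᵇ-true lt

-x*-y≡x*y : ∀ a b → (- a) * (- b) ≡ a * b
-x*-y≡x*y a b = trans (sym (ℚP.neg-distribˡ-* a (- b))) (trans (cong -_ (sym (ℚP.neg-distribʳ-* a b))) (-‿involutive (a * b)))

-- Contracting chains

module ChainContraction (k m : ℕ) where
  n = k + m

  Inner : Fin n → Set
  Inner x = k ≤ toℕ x

  src<k : ∀ i → toℕ (i ↑ˡ m) < k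
  src<k i = subst (_< k) (sym (toℕ-↑ˡ i m)) (toℕ<n i)

  ↑ˡ≢inner : ∀ i x → Inner x → i ↑ˡ m ≢ x
  ↑ˡ≢inner i x inn e = ℕP.<⇒≱ (src<k i) (subst (λ z → k ≤ toℕ z) (sym e) inn)

  inner-↑ʳ : ∀ w → Inner (k ↑ʳ w)
  inner-↑ʳ w = subst (k ≤_) (sym (toℕ-↑ʳ k w)) (ℕP.m≤m+n k (toℕ w))

  source-or-inner : ∀ (x : Fin n) → (Σ (Fin k) λ i → x ≡ i ↑ˡ m) ⊎ Inner x
  source-or-inner x with splitAt k x in eq
  ... | inj₁ i = inj₁ (i , trans (sym (join-splitAt k m x)) (cong (join k m) eq))
  ... | inj₂ w = inj₂ (subst Inner (trans (cong (join k m) (sym eq)) (join-splitAt k m x)) (inner-↑ʳ w))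

  -- Rows of V_S and of V_T are both indexed by Fin n; the indices below k are the sources,
  -- resp. the sinks.  A chain from x to j follows π through inner indices until it hits j ↑ˡ m.
  data Chain (π : Fin n → Fin n) : Fin n → Fin k → Set where
    done : ∀ {x j} → π x ≡ j ↑ˡ m → Chain π x j
    next : ∀ {x j} → Inner (π x) → Chain π (π x) j → Chain π x j

  -- For the π of a common base, weight π x is the sign s_e of the column in row x:
  -- F₁-columns (all source rows, and the inner rows moved by π) have s_e = −1.
  weight : (Fin n → Fin n) → Fin n → ℚ
  weight π x = if (toℕ x <ᵇ k) ∨ not (does (π x Fin.≟ x)) then - 1ℚ else 1ℚ

  movedInner : (Fin n → Fin n) → Fin n → ℕ
  movedInner π x = ind (not (toℕ x <ᵇ k) ∧ not (does (π x Fin.≟ x)))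

  #movedInner : (Fin n → Fin n) → ℕ
  #movedInner π = Σn n (movedInner π)

  weight-source : ∀ π z → toℕ z < k → weight π z ≡ - 1ℚ
  weight-source π z lt rewrite <⇒<ᵇ-true lt = refl

  movedInner-source : ∀ π z → toℕ z < k → movedInner π z ≡ 0
  movedInner-source π z lt rewrite <⇒<ᵇ-true lt = refl

  record ChainSystem (σ : Fin k → Fin k) : Set where
    field
      π           : Fin n → Fin n
      π⁻¹         : Fin n → Fin n
      π-π⁻¹       : ∀ y → π (π⁻¹ y) ≡ y
      π-injective : Injective _≡_ _≡_ π
      chain       : ∀ i → Chain π (i ↑ˡ m) (σ i)
      depth       : Fin n → ℕ
      depth-<     : ∀ x → Inner x → π x ≢ x → Inner (π x) → depth x < depth (π x)

  module Transfer (π π′ : Fin n → Fin n) (π-injective : Injective _≡_ _≡_ π) (u x : Fin n) (u<k : toℕ u < k)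
                  (πu : π u ≡ x) (agree : ∀ z → z ≢ u → z ≢ x → π′ z ≡ π z) where
    inner≢u : ∀ z → Inner z → z ≢ u
    inner≢u z inn e = ℕP.<⇒≱ u<k (subst (λ w → k ≤ toℕ w) e inn)

    transfer : ∀ {y j} → Chain π y j → y ≢ u → y ≢ x → Chain π′ y j
    transfer {y} (done e) y≢u y≢x = done (trans (agree y y≢u y≢x) e)
    transfer {y} {j} (next inn c) y≢u y≢x = next (subst Inner (sym π′y) inn) (subst (λ z → Chain π′ z j) (sym π′y)
          (transfer c (inner≢u (π y) inn) (λ e → y≢u (π-injective (trans e (sym πu))))))
      where π′y = agree y y≢u y≢x

  -- Contracting the first edge u → x of the chain from the source u = i₀ ↑ˡ m makes x a fixed
  -- point and lets u jump directly to π x.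
  module Contract {σ} (C : ChainSystem σ) (i₀ : Fin k) (inn : Inner (ChainSystem.π C (i₀ ↑ˡ m))) where
    open ChainSystem C
    u = i₀ ↑ˡ m
    x = π u
    π′ : Fin n → Fin n
    π′ y = π (transpose u x y)
    u≢x : u ≢ x
    u≢x = ↑ˡ≢inner i₀ x inn
    πx≢x : π x ≢ x
    πx≢x e = u≢x (π-injective (sym e))
    π′u : π′ u ≡ π x
    π′u = cong π (transpose-first u x)
    π′x : π′ x ≡ x
    π′x = cong π (transpose-second u x)
    agree : ∀ z → z ≢ u → z ≢ x → π′ z ≡ π z
    agree z z≢u z≢x = cong π (transpose-other u x z z≢u z≢x)
    x<ᵇk : (toℕ x <ᵇ k) ≡ false
    x<ᵇk = ≤⇒<ᵇ-false inn

    open Transfer π π′ π-injective u x (src<k i₀) refl agree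

    chain-u : ∀ {j} → Chain π u j → Chain π′ u j
    chain-u (done e) = ⊥-elim (↑ˡ≢inner _ x inn (sym e))
    chain-u (next _ (done e)) = done (trans π′u e)
    chain-u {j} (next _ (next inn′ c)) = next (subst Inner (sym π′u) inn′)
       (subst (λ z → Chain π′ z j) (sym π′u) (transfer c (inner≢u (π x) inn′) πx≢x))

    chain′ : ∀ i → Chain π′ (i ↑ˡ m) (σ i)
    chain′ i with i Fin.≟ i₀
    ... | yes refl = chain-u (chain i)
    ... | no i≢i₀ = transfer (chain i) (i≢i₀ ∘ ↑ˡ-injective m i i₀) (↑ˡ≢inner i x inn)

    depth-<′ : ∀ y → Inner y → π′ y ≢ y → Inner (π′ y) → depth y < depth (π′ y)
    depth-<′ y inny π′y≢y inn′ = by-cases (y Fin.≟ x)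
      where
      by-cases : Dec (y ≡ x) → depth y < depth (π′ y)
      by-cases (yes refl) = ⊥-elim (π′y≢y π′x)
      by-cases (no y≢x) = subst (λ z → depth y < depth z) (sym π′y) (depth-< y inny (subst (_≢ y) π′y π′y≢y) (subst Inner π′y inn′))
        where
        π′y : π′ y ≡ π y
        π′y = agree y (λ e → ↑ˡ≢inner i₀ y inny (sym e)) y≢x

    contracted : ChainSystem σ
    contracted = record
      { π = π′ ; π⁻¹ = λ y → transpose u x (π⁻¹ y)
      ; π-π⁻¹ = λ y → trans (cong π (transpose-involutive u x (π⁻¹ y))) (π-π⁻¹ y)
      ; π-injective = ∘-injective π-injective (transpose-injective u x)
      ; chain = chain′ ; depth = depth ; depth-< = depth-<′ }

    sgnF-contracted : sgnF n π′ ≡ - sgnF n π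
    sgnF-contracted = trans (sgnF-comp n π (transpose u x) π-injective (transpose-injective u x))
      (trans (cong (sgnF n π *_) (sgnF-transpose n u x u≢x)) (trans (ℚP.*-comm (sgnF n π) (- 1ℚ)) (-1*x≈-x (sgnF n π))))

    weight-agree : ∀ z → z ≢ x → weight π z ≡ weight π′ z
    weight-agree z z≢x = by-cases (z Fin.≟ u)
      where
      by-cases : Dec (z ≡ u) → weight π z ≡ weight π′ z
      by-cases (yes refl) = trans (weight-source π u (src<k i₀)) (sym (weight-source π′ u (src<k i₀)))
      by-cases (no z≢u) = cong (λ w → if (toℕ z <ᵇ k) ∨ not (does (w Fin.≟ z)) then - 1ℚ else 1ℚ) (sym (agree z z≢u z≢x))

    weight-x : weight π x ≡ - 1ℚ
    weight-x rewrite x<ᵇk with π x Fin.≟ x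
    ... | yes e = ⊥-elim (πx≢x e)
    ... | no _ = refl

    weight′-x : weight π′ x ≡ 1ℚ
    weight′-x rewrite x<ᵇk | π′x with x Fin.≟ x
    ... | yes _ = refl
    ... | no x≢x = ⊥-elim (x≢x refl)

    Πweight-contracted : Πq n (weight π′) ≡ - Πq n (weight π)
    Πweight-contracted = begin
      P′                        ≡⟨ sym (ℚP.*-identityʳ P′) ⟩
      P′ * 1ℚ                   ≡⟨ cong (P′ *_) (sym (-x*-y≡x*y 1ℚ 1ℚ)) ⟩
      P′ * ((- 1ℚ) * (- 1ℚ))    ≡⟨ sym (ℚP.*-assoc P′ (- 1ℚ) (- 1ℚ)) ⟩
      (P′ * (- 1ℚ)) * (- 1ℚ)    ≡⟨ cong (λ z → (P′ * z) * (- 1ℚ)) (sym weight-x) ⟩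
      (P′ * weight π x) * (- 1ℚ) ≡⟨ cong (_* (- 1ℚ)) (sym (Πq-exchange (weight π) (weight π′) x weight-agree)) ⟩
      (P * weight π′ x) * (- 1ℚ) ≡⟨ cong (λ z → (P * z) * (- 1ℚ)) weight′-x ⟩
      (P * 1ℚ) * (- 1ℚ)         ≡⟨ cong (_* (- 1ℚ)) (ℚP.*-identityʳ P) ⟩
      P * (- 1ℚ)                ≡⟨ trans (ℚP.*-comm P (- 1ℚ)) (-1*x≈-x P) ⟩
      - P                       ∎
      where
      open ≡-Reasoning
      P = Πq n (weight π)
      P′ = Πq n (weight π′)

    sgnF*Πweight-contracted : sgnF n π′ * Πq n (weight π′) ≡ sgnF n π * Πq n (weight π)
    sgnF*Πweight-contracted =
      trans (cong₂ _*_ sgnF-contracted Πweight-contracted) (-x*-y≡x*y (sgnF n π) (Πq n (weight π)))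

    movedInner-agree : ∀ z → z ≢ x → movedInner π z ≡ movedInner π′ z
    movedInner-agree z z≢x = by-cases (z Fin.≟ u)
      where
      by-cases : Dec (z ≡ u) → movedInner π z ≡ movedInner π′ z
      by-cases (yes refl) = trans (movedInner-source π u (src<k i₀)) (sym (movedInner-source π′ u (src<k i₀)))
      by-cases (no z≢u) = cong (λ w → ind (not (toℕ z <ᵇ k) ∧ not (does (w Fin.≟ z)))) (sym (agree z z≢u z≢x))

    movedInner-x : movedInner π x ≡ 1
    movedInner-x rewrite x<ᵇk with π x Fin.≟ x
    ... | yes e = ⊥-elim (πx≢x e)
    ... | no _ = refl

    movedInner′-x : movedInner π′ x ≡ 0
    movedInner′-x rewrite x<ᵇk | π′x with x Fin.≟ x
    ... | yes _ = refl
    ... | no x≢x = ⊥-elim (x≢x refl)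

    #movedInner-contracted : #movedInner π ≡ suc (#movedInner π′)
    #movedInner-contracted = begin
      #movedInner π                          ≡⟨ sym (ℕP.+-identityʳ _) ⟩
      #movedInner π + 0                      ≡⟨ cong (#movedInner π +_) (sym movedInner′-x) ⟩
      #movedInner π + movedInner π′ x        ≡⟨ Σn-exchange (movedInner π) (movedInner π′) x movedInner-agree ⟩
      #movedInner π′ + movedInner π x        ≡⟨ cong (#movedInner π′ +_) movedInner-x ⟩
      #movedInner π′ + 1                     ≡⟨ ℕP.+-comm _ 1 ⟩
      suc (#movedInner π′)                   ∎
      where open ≡-Reasoning

  -- Once no chain passes through an inner index, the depth function rules out cycles of π among
  -- the inner indices, so they are all fixed.
  module Direct {σ} (C : ChainSystem σ) (direct : ¬ (∃ λ i → Inner (ChainSystem.π C (i ↑ˡ m)))) where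
    open ChainSystem C

    inner-fixed-below : ∀ s x → depth x < s → Inner x → π x ≡ x
    inner-fixed-below (suc s) x lt inn with π x Fin.≟ x
    ... | yes e = e
    ... | no πx≢x with source-or-inner (π⁻¹ x)
    ...   | inj₁ (i , e) = ⊥-elim (direct (i , subst Inner (sym (trans (cong π (sym e)) (π-π⁻¹ x))) inn))
    ...   | inj₂ inny = ⊥-elim (πy≢y (inner-fixed-below s y (ℕP.≤-trans (subst (λ z → suc (depth y) ≤ depth z) (π-π⁻¹ x) y<πy) (ℕP.≤-pred lt)) inny))
      where
      y = π⁻¹ x
      πy≢y : π y ≢ y
      πy≢y e = πx≢x (trans (cong π (sym (trans (sym e) (π-π⁻¹ x)))) (π-π⁻¹ x))
      y<πy : depth y < depth (π y)
      y<πy = depth-< y inny πy≢y (subst Inner (sym (π-π⁻¹ x)) inn)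

    inner-fixed : ∀ x → Inner x → π x ≡ x
    inner-fixed x = inner-fixed-below (suc (depth x)) x ℕP.≤-refl

    π≡extendById : ∀ x → π x ≡ extendById k m σ x
    π≡extendById x with source-or-inner x
    ... | inj₁ (i , refl) with chain i
    ...   | done e = trans e (sym (extendById-↑ˡ k m σ i))
    ...   | next inn _ = ⊥-elim (direct (i , inn))
    π≡extendById x | inj₂ inn with splitAt k x in eq
    ... | inj₁ i = ⊥-elim (↑ˡ≢inner i x inn (trans (sym (cong (join k m) eq)) (join-splitAt k m x)))
    ... | inj₂ w = trans (inner-fixed x inn) (trans (sym (join-splitAt k m x)) (cong (join k m) eq))

    Πweight≡sgnℕ : Πq n (weight π) ≡ sgnℕ k
    Πweight≡sgnℕ = trans (Πq-↑ k m (weight π)) (trans (cong₂ _*_ (Πq-cong k weight-↑ˡ) (Πq-cong m weight-↑ʳ))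
                     (trans (cong₂ _*_ (Πq-neg1 k) (Πq-1 m)) (ℚP.*-identityʳ _)))
      where
      weight-↑ˡ : ∀ i → weight π (i ↑ˡ m) ≡ - 1ℚ
      weight-↑ˡ i = weight-source π (i ↑ˡ m) (src<k i)
      weight-↑ʳ : ∀ w → weight π (k ↑ʳ w) ≡ 1ℚ
      weight-↑ʳ w rewrite ≤⇒<ᵇ-false (inner-↑ʳ w) | inner-fixed (k ↑ʳ w) (inner-↑ʳ w) with (k ↑ʳ w) Fin.≟ (k ↑ʳ w)
      ... | yes _ = refl
      ... | no ne = ⊥-elim (ne refl)

    sign-of-direct-chains : sgnF n π * Πq n (weight π) ≡ sgnℕ k * sgnF k σ
    sign-of-direct-chains =
      trans (cong₂ _*_ (trans (sgnF-cong n π≡extendById) (sgnF-extendById k m σ)) Πweight≡sgnℕ) (ℚP.*-comm (sgnF k σ) (sgnℕ k))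

  sign-of-chains : ∀ {σ} (C : ChainSystem σ) →
                   sgnF n (ChainSystem.π C) * Πq n (weight (ChainSystem.π C)) ≡ sgnℕ k * sgnF k σ
  sign-of-chains C = go (#movedInner (ChainSystem.π C)) C ℕP.≤-refl
    where
    go : ∀ t {σ} (C : ChainSystem σ) → #movedInner (ChainSystem.π C) ≤ t →
         sgnF n (ChainSystem.π C) * Πq n (weight (ChainSystem.π C)) ≡ sgnℕ k * sgnF k σ
    go t C bound with any? (λ i → k ≤? toℕ (ChainSystem.π C (i ↑ˡ m)))
    ... | no direct = Direct.sign-of-direct-chains C direct
    go zero C bound | yes (i₀ , inn) =
      ⊥-elim (ℕP.<⇒≱ (subst (0 <_) (sym (Contract.#movedInner-contracted C i₀ inn)) (s≤s z≤n)) bound)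
    go (suc t) C bound | yes (i₀ , inn) =
      trans (sym (sgnF*Πweight-contracted)) (go t contracted (ℕP.≤-pred (subst (_≤ suc t) #movedInner-contracted bound)))
      where open Contract C i₀ inn

-- Determinants of monomial matrices

Σℚ-cong : ∀ n {f g : Fin n → ℚ} → (∀ i → f i ≡ g i) → Σℚ n f ≡ Σℚ n g
Σℚ-cong n {f} {g} eq = trans (Σℚ≡Big n f) (trans (SumRat.Big-cong n eq) (sym (Σℚ≡Big n g)))

Σℚ-0 : ∀ n {f : Fin n → ℚ} → (∀ i → f i ≡ 0ℚ) → Σℚ n f ≡ 0ℚ
Σℚ-0 n {f} eq = trans (Σℚ≡Big n f) (SumRat.Big-ε n eq)

det-cong : ∀ n {A B : Fin n → Fin n → ℚ} → (∀ i j → A i j ≡ B i j) → det n A ≡ det n B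
det-cong zero eq = refl
det-cong (suc n) eq = Σℚ-cong (suc n) (λ j → cong₂ (λ a b → sgnℕ (toℕ j) * (a * b)) (eq zero j)
                        (det-cong n (λ i j′ → eq (suc i) (punchIn j j′))))

det-zero-row : ∀ n (A : Fin n → Fin n → ℚ) i₀ → (∀ j → A i₀ j ≡ 0ℚ) → det n A ≡ 0ℚ
det-zero-row (suc n) A zero eq = Σℚ-0 (suc n) λ j → let D = det n (λ i j′ → A (suc i) (punchIn j j′)) in
   trans (cong (λ a → sgnℕ (toℕ j) * (a * D)) (eq j))
   (trans (cong (sgnℕ (toℕ j) *_) (ℚP.*-zeroˡ D)) (ℚP.*-zeroʳ (sgnℕ (toℕ j))))
det-zero-row (suc n) A (suc i) eq = Σℚ-0 (suc n) λ j → trans (cong (λ a → sgnℕ (toℕ j) * (A zero j * a))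
   (det-zero-row n (λ i′ j′ → A (suc i′) (punchIn j j′)) i (λ j′ → eq (punchIn j j′))))
   (trans (cong (sgnℕ (toℕ j) *_) (ℚP.*-zeroʳ (A zero j))) (ℚP.*-zeroʳ (sgnℕ (toℕ j))))

monomial : ∀ {n} → (Fin n → Fin n) → (Fin n → ℚ) → Fin n → Fin n → ℚ
monomial r c x j = if does (r j Fin.≟ x) then c j else 0ℚ

-- In the Laplace expansion along row 0 only the column j₀ with r j₀ = 0 contributes.
det-monomial : ∀ n (r : Fin n → Fin n) (c : Fin n → ℚ) → Injective _≡_ _≡_ r → det n (monomial r c) ≡ sgnF n r * Πq n c
det-monomial zero r c inj = refl
det-monomial (suc n) r c inj = begin
    det (suc n) (monomial r c) ≡⟨ Σℚ≡Big (suc n) term ⟩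
    SumRat.Big (suc n) term ≡⟨ SumRat.Big-punchIn n term j₀ ⟩
    term j₀ ℚ.+ SumRat.Big n (λ q → term (punchIn j₀ q)) ≡⟨ cong (term j₀ ℚ.+_) (SumRat.Big-ε n term-vanishes) ⟩
    term j₀ ℚ.+ 0ℚ ≡⟨ ℚP.+-identityʳ (term j₀) ⟩
    term j₀ ≡⟨ cong₂ (λ a b → s * (a * b)) cj₀ (trans (det-cong n minor-eq) (det-monomial n (remove r j₀) c′ (remove-injective r inj j₀))) ⟩
    s * (c j₀ * (R * P)) ≡⟨ solve 4 (λ S C R′ P′ → S ⊕ (C ⊕ (R′ ⊕ P′)) ⊜ ((ι ⊕ S) ⊕ R′) ⊕ (C ⊕ P′)) refl s (c j₀) R P ⟩
    ((1ℚ * s) * R) * (c j₀ * P) ≡⟨ cong₂ _*_ (cong (λ z → (sgnℕ (toℕ z) * s) * R) (sym rj₀)) refl ⟩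
    ((sgnℕ (toℕ (r j₀)) * s) * R) * (c j₀ * P) ≡⟨ cong₂ _*_ (sym (sgnF-remove n r inj j₀)) (sym (Πq-punchIn n c j₀)) ⟩
    sgnF (suc n) r * Πq (suc n) c ∎
  where
  open ≡-Reasoning
  j₀ = SelfMapInverse.sec (suc n) r inj zero
  rj₀ : r j₀ ≡ zero
  rj₀ = SelfMapInverse.f-sec (suc n) r inj zero
  s = sgnℕ (toℕ j₀)
  c′ = λ q → c (punchIn j₀ q)
  R = sgnF n (remove r j₀)
  P = Πq n c′
  term : Fin (suc n) → ℚ
  term j = sgnℕ (toℕ j) * (monomial r c zero j * det n (λ i j′ → monomial r c (suc i) (punchIn j j′)))
  term-vanishes : ∀ q → term (punchIn j₀ q) ≡ 0ℚ
  term-vanishes q with r (punchIn j₀ q) Fin.≟ zero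
  ... | yes e = ⊥-elim (punchInᵢ≢i j₀ q (inj (trans e (sym rj₀))))
  ... | no _ = trans (cong (sgnℕ (toℕ (punchIn j₀ q)) *_) (ℚP.*-zeroˡ (det n (λ i j′ → monomial r c (suc i) (punchIn (punchIn j₀ q) j′))))) (ℚP.*-zeroʳ (sgnℕ (toℕ (punchIn j₀ q))))
  cj₀ : monomial r c zero j₀ ≡ c j₀
  cj₀ rewrite rj₀ = refl
  minor-eq : ∀ i q → monomial r c (suc i) (punchIn j₀ q) ≡ monomial (remove r j₀) c′ i q
  minor-eq i q rewrite punchIn-remove r inj j₀ q | rj₀ = refl

±1 : ℚ → Set
±1 x = x ≡ 1ℚ ⊎ x ≡ - 1ℚ

±1-* : ∀ {a b} → ±1 a → ±1 b → ±1 (a * b)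
±1-* (inj₁ refl) (inj₁ refl) = inj₁ refl
±1-* (inj₁ refl) (inj₂ refl) = inj₂ refl
±1-* (inj₂ refl) (inj₁ refl) = inj₂ refl
±1-* (inj₂ refl) (inj₂ refl) = inj₁ refl

±1-neg : ∀ {a} → ±1 a → ±1 (- a)
±1-neg (inj₁ refl) = inj₂ refl
±1-neg (inj₂ refl) = inj₁ refl

±1-sgnℕ : ∀ a → ±1 (sgnℕ a)
±1-sgnℕ zero = inj₁ refl
±1-sgnℕ (suc a) = ±1-neg (±1-sgnℕ a)

±1⇒≢0 : ∀ {a} → ±1 a → a ≢ 0ℚ
±1⇒≢0 (inj₁ refl) ()
±1⇒≢0 (inj₂ refl) ()

±1-Πq : ∀ n (c : Fin n → ℚ) → (∀ j → ±1 (c j)) → ±1 (Πq n c)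
±1-Πq zero c h = inj₁ refl
±1-Πq (suc n) c h = ±1-* (h zero) (±1-Πq n (λ j → c (suc j)) (λ j → h (suc j)))

det-monomial≢0⇒surjective : ∀ n (r : Fin n → Fin n) (c : Fin n → ℚ) → det n (monomial r c) ≢ 0ℚ → ∀ x → ∃ λ j → r j ≡ x
det-monomial≢0⇒surjective n r c nz x with any? (λ j → r j Fin.≟ x)
... | yes p = p
... | no ¬p = ⊥-elim (nz (det-zero-row n (monomial r c) x zr))
  where
  zr : ∀ j → monomial r c x j ≡ 0ℚ
  zr j with r j Fin.≟ x
  ... | yes e = ⊥-elim (¬p (j , e))
  ... | no _ = refl

surjective⇒injective : ∀ n (r : Fin n → Fin n) → (∀ x → ∃ λ j → r j ≡ x) → Injective _≡_ _≡_ r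
surjective⇒injective n r sur {j} {j′} e = trans (sym p) (trans (cong s xx′) p′)
  where
  s : Fin n → Fin n
  s x = proj₁ (sur x)
  rs : ∀ x → r (s x) ≡ x
  rs x = proj₂ (sur x)
  sinj : Injective _≡_ _≡_ s
  sinj {a} {b} e = trans (sym (rs a)) (trans (cong r e) (rs b))
  pre : ∀ j → ∃ λ x → s x ≡ j
  pre = injective⇒surjective n s sinj
  x = proj₁ (pre j)
  p = proj₂ (pre j)
  x′ = proj₁ (pre j′)
  p′ = proj₂ (pre j′)
  xx′ : x ≡ x′
  xx′ = trans (sym (rs x)) (trans (cong r p) (trans e (trans (cong r (sym p′)) (rs x′))))

inj₂≢inj₁ : ∀ {A B : Set} {a : A} {c : B} → inj₂ a ≢ inj₁ c
inj₂≢inj₁ ()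

lookup-injective : ∀ {A : Set} (xs : List A) → Unique xs → ∀ {i j} → lookup xs i ≡ lookup xs j → i ≡ j
lookup-injective (x ∷ xs) (_ ∷ u) {zero} {zero} e = refl
lookup-injective (x ∷ xs) (a ∷ u) {zero} {suc j} e = ⊥-elim (All.lookup a (∈-lookup j) e)
lookup-injective (x ∷ xs) (a ∷ u) {suc i} {zero} e = ⊥-elim (All.lookup a (∈-lookup i) (sym e))
lookup-injective (x ∷ xs) (_ ∷ u) {suc i} {suc j} e = cong suc (lookup-injective xs u e)

does-cong-⇔ : ∀ {P Q : Set} (p : Dec P) (q : Dec Q) → (P → Q) → (Q → P) → does p ≡ does q
does-cong-⇔ (yes p) (yes q) f g = refl
does-cong-⇔ (yes p) (no ¬q) f g = ⊥-elim (¬q (f p))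
does-cong-⇔ (no ¬p) (yes q) f g = ⊥-elim (¬p (g q))
does-cong-⇔ (no ¬p) (no ¬q) f g = refl

indℚ : Bool → ℚ
indℚ b = if b then 1ℚ else 0ℚ

indℚ* : ∀ b c → indℚ b * c ≡ (if b then c else 0ℚ)
indℚ* true c = ℚP.*-identityˡ c
indℚ* false c = ℚP.*-zeroˡ c

module Rows (k m : ℕ) where
  n = k + m
  V = Vtx k m

  _≟V_ : (u v : V) → Dec (u ≡ v)
  src i ≟V src j with i Fin.≟ j
  ... | yes refl = yes refl
  ... | no ne = no λ { refl → ne refl }
  snk i ≟V snk j with i Fin.≟ j
  ... | yes refl = yes refl
  ... | no ne = no λ { refl → ne refl }
  mid i ≟V mid j with i Fin.≟ j
  ... | yes refl = yes refl
  ... | no ne = no λ { refl → ne refl }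
  src _ ≟V snk _ = no λ ()
  src _ ≟V mid _ = no λ ()
  snk _ ≟V src _ = no λ ()
  snk _ ≟V mid _ = no λ ()
  mid _ ≟V src _ = no λ ()
  mid _ ≟V snk _ = no λ ()

  NotSnk : V → Set
  NotSnk (snk _) = ⊥
  NotSnk _ = ⊤

  NotSrc : V → Set
  NotSrc (src _) = ⊥
  NotSrc _ = ⊤

  notSnk? : (v : V) → Dec (NotSnk v)
  notSnk? (src _) = yes tt
  notSnk? (snk _) = no (λ ())
  notSnk? (mid _) = yes tt

  sRow : V → Fin n
  sRow (src i) = i ↑ˡ m
  sRow (snk j) = j ↑ˡ m
  sRow (mid w) = k ↑ʳ w

  tRow : V → Fin n
  tRow (src i) = i ↑ˡ m
  tRow (snk j) = j ↑ˡ m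
  tRow (mid w) = k ↑ʳ w

  ↑ˡ≢↑ʳ : ∀ (i : Fin k) (w : Fin m) → i ↑ˡ m ≢ k ↑ʳ w
  ↑ˡ≢↑ʳ i w e = ℕP.<⇒≱ (subst (_< k) (sym (toℕ-↑ˡ i m)) (toℕ<n i))
                  (subst (λ z → k ≤ toℕ z) (sym e) (subst (k ≤_) (sym (toℕ-↑ʳ k w)) (ℕP.m≤m+n k (toℕ w))))

  sRow-inj : ∀ {u v} → NotSnk u → NotSnk v → sRow u ≡ sRow v → u ≡ v
  sRow-inj {src i} {src j} _ _ e = cong src (↑ˡ-injective m i j e)
  sRow-inj {src i} {mid w} _ _ e = ⊥-elim (↑ˡ≢↑ʳ i w e)
  sRow-inj {mid w} {src i} _ _ e = ⊥-elim (↑ˡ≢↑ʳ i w (sym e))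
  sRow-inj {mid w} {mid w′} _ _ e = cong mid (↑ʳ-injective k w w′ e)

  tRow-inj : ∀ {u v} → NotSrc u → NotSrc v → tRow u ≡ tRow v → u ≡ v
  tRow-inj {snk i} {snk j} _ _ e = cong snk (↑ˡ-injective m i j e)
  tRow-inj {snk i} {mid w} _ _ e = ⊥-elim (↑ˡ≢↑ʳ i w e)
  tRow-inj {mid w} {snk i} _ _ e = ⊥-elim (↑ˡ≢↑ʳ i w (sym e))
  tRow-inj {mid w} {mid w′} _ _ e = cong mid (↑ʳ-injective k w w′ e)

  vtxOf : Fin n → V
  vtxOf x = [ src , mid ]′ (splitAt k x)

  sRow-vtxOf : ∀ x → sRow (vtxOf x) ≡ x
  sRow-vtxOf x = trans (h (splitAt k x)) (join-splitAt k m x)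
    where
    h : ∀ s → sRow ([ src , mid ]′ s) ≡ join k m s
    h (inj₁ i) = refl
    h (inj₂ w) = refl

  ns-vtxOf : ∀ x → NotSnk (vtxOf x)
  ns-vtxOf x = h (splitAt k x)
    where
    h : ∀ s → NotSnk ([ src , mid ]′ s)
    h (inj₁ i) = tt
    h (inj₂ w) = tt

  vtxOf-sRow : ∀ v → NotSnk v → vtxOf (sRow v) ≡ v
  vtxOf-sRow (src i) _ = cong [ src , mid ]′ (FinP.splitAt-↑ˡ k i m)
  vtxOf-sRow (mid w) _ = cong [ src , mid ]′ (FinP.splitAt-↑ʳ k m w)

  splitAt≡⇒≡join : ∀ (x : Fin n) {s} → splitAt k x ≡ s → x ≡ join k m s
  splitAt≡⇒≡join x eq = trans (sym (join-splitAt k m x)) (cong (join k m) eq)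

  isS-row : ∀ x u → NotSnk u → isS (splitAt k x) u ≡ indℚ (does (sRow u Fin.≟ x))
  isS-row x u ns with splitAt k x in eq
  isS-row x (src i′) ns | inj₁ i = cong indℚ (does-cong-⇔ (i Fin.≟ i′) (i′ ↑ˡ m Fin.≟ x)
      (λ e → trans (cong (_↑ˡ m) (sym e)) (sym (splitAt≡⇒≡join x eq))) (λ e → ↑ˡ-injective m i i′ (sym (trans e (splitAt≡⇒≡join x eq)))))
  isS-row x (mid w) ns | inj₁ i = sym (cong indℚ (dec-false (k ↑ʳ w Fin.≟ x) (λ e → ↑ˡ≢↑ʳ i w (sym (trans e (splitAt≡⇒≡join x eq))))))
  isS-row x (src i′) ns | inj₂ w = sym (cong indℚ (dec-false (i′ ↑ˡ m Fin.≟ x) (λ e → ↑ˡ≢↑ʳ i′ w (trans e (splitAt≡⇒≡join x eq)))))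
  isS-row x (mid w′) ns | inj₂ w = cong indℚ (does-cong-⇔ (w Fin.≟ w′) (k ↑ʳ w′ Fin.≟ x)
      (λ e → trans (cong (k ↑ʳ_) (sym e)) (sym (splitAt≡⇒≡join x eq))) (λ e → ↑ʳ-injective k w w′ (sym (trans e (splitAt≡⇒≡join x eq)))))

  isT-row : ∀ y v → NotSrc v → isT (splitAt k y) v ≡ indℚ (does (tRow v Fin.≟ y))
  isT-row x v ns with splitAt k x in eq
  isT-row x (snk i′) ns | inj₁ i = cong indℚ (does-cong-⇔ (i Fin.≟ i′) (i′ ↑ˡ m Fin.≟ x)
      (λ e → trans (cong (_↑ˡ m) (sym e)) (sym (splitAt≡⇒≡join x eq))) (λ e → ↑ˡ-injective m i i′ (sym (trans e (splitAt≡⇒≡join x eq)))))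
  isT-row x (mid w) ns | inj₁ i = sym (cong indℚ (dec-false (k ↑ʳ w Fin.≟ x) (λ e → ↑ˡ≢↑ʳ i w (sym (trans e (splitAt≡⇒≡join x eq))))))
  isT-row x (snk i′) ns | inj₂ w = sym (cong indℚ (dec-false (i′ ↑ˡ m Fin.≟ x) (λ e → ↑ˡ≢↑ʳ i′ w (trans e (splitAt≡⇒≡join x eq)))))
  isT-row x (mid w′) ns | inj₂ w = cong indℚ (does-cong-⇔ (w Fin.≟ w′) (k ↑ʳ w′ Fin.≟ x)
      (λ e → trans (cong (k ↑ʳ_) (sym e)) (sym (splitAt≡⇒≡join x eq))) (λ e → ↑ʳ-injective k w w′ (sym (trans e (splitAt≡⇒≡join x eq)))))

module Incidence (k m : ℕ) (G : Graph k m) (inS : SourcesHaveInDeg0 G) (outT : SinksHaveOutDeg0 G) where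
  open Rows k m public
  E = edges G
  L = length E
  N = |F| G

  eSrc : Fin L → V
  eSrc ℓ = proj₁ (lookup E ℓ)
  eTgt : Fin L → V
  eTgt ℓ = proj₂ (lookup E ℓ)

  edge-mem : ∀ ℓ → Edge G (eSrc ℓ) (eTgt ℓ)
  edge-mem ℓ = ∈-lookup ℓ

  eSrc-ns : ∀ ℓ → NotSnk (eSrc ℓ)
  eSrc-ns ℓ with eSrc ℓ in eq
  ... | src _ = tt
  ... | mid _ = tt
  ... | snk j = outT j (eTgt ℓ) (subst (λ z → Edge G z (eTgt ℓ)) eq (edge-mem ℓ))

  eTgt-ns : ∀ ℓ → NotSrc (eTgt ℓ)
  eTgt-ns ℓ with eTgt ℓ in eq
  ... | snk _ = tt
  ... | mid _ = tt
  ... | src i = inS (eSrc ℓ) i (subst (λ z → Edge G (eSrc ℓ) z) eq (edge-mem ℓ))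

  rowUˢ : Fin L ⊎ Fin m → Fin n
  rowUˢ = [ (λ ℓ → sRow (eSrc ℓ)) , (k ↑ʳ_) ]′

  rowVˢ : Fin L ⊎ Fin m → Fin n
  rowVˢ = [ (λ ℓ → tRow (eTgt ℓ)) , (k ↑ʳ_) ]′

  rowU : Fin N → Fin n
  rowU e = rowUˢ (splitAt L e)

  rowV : Fin N → Fin n
  rowV e = rowVˢ (splitAt L e)

  A⃗₁-column : ∀ x e → A⃗₁ G x e ≡ (if does (rowU e Fin.≟ x) then sₑ G e else 0ℚ)
  A⃗₁-column x e with splitAt L e
  ... | inj₁ ℓ = trans (cong (_* (- 1ℚ)) (isS-row x (eSrc ℓ) (eSrc-ns ℓ))) (indℚ* (does (sRow (eSrc ℓ) Fin.≟ x)) (- 1ℚ))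
  ... | inj₂ w = trans (cong (_* 1ℚ) (isS-row x (mid w) tt)) (indℚ* (does ((k ↑ʳ w) Fin.≟ x)) 1ℚ)

  A⃗₂-column : ∀ x e → A⃗₂ G x e ≡ (if does (rowV e Fin.≟ x) then 1ℚ else 0ℚ)
  A⃗₂-column x e with splitAt L e
  ... | inj₁ ℓ = isT-row x (eTgt ℓ) (eTgt-ns ℓ)
  ... | inj₂ w = isT-row x (mid w) tt

data Consec {A : Set} : List A → A → A → Set where
  here : ∀ {a b xs} → Consec (a ∷ b ∷ xs) a b
  there : ∀ {x xs a b} → Consec xs a b → Consec (x ∷ xs) a b

consec-mem₁ : ∀ {A : Set} {xs : List A} {a c} → Consec xs a c → a ∈ xs
consec-mem₁ here = here refl
consec-mem₁ (there cs) = there (consec-mem₁ cs)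

consec-mem₂ : ∀ {A : Set} {xs : List A} {a c} → Consec xs a c → c ∈ xs
consec-mem₂ here = there (here refl)
consec-mem₂ (there cs) = there (consec-mem₂ cs)

consec-unique-right : ∀ {A : Set} {xs : List A} {a c c′} → Unique xs → Consec xs a c → Consec xs a c′ → c ≡ c′
consec-unique-right u here here = refl
consec-unique-right (px ∷ u) here (there cs) = ⊥-elim (All.lookup px (consec-mem₁ cs) refl)
consec-unique-right (px ∷ u) (there cs) here = ⊥-elim (All.lookup px (consec-mem₁ cs) refl)
consec-unique-right (px ∷ u) (there cs) (there cs′) = consec-unique-right u cs cs′

consec-unique-left : ∀ {A : Set} {xs : List A} {a a′ c} → Unique xs → Consec xs a c → Consec xs a′ c → a ≡ a′
consec-unique-left u here here = refl
consec-unique-left (px ∷ (py ∷ u)) here (there here) = ⊥-elim (All.lookup py (here refl) refl)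
consec-unique-left (px ∷ (py ∷ u)) here (there (there cs)) = ⊥-elim (All.lookup py (consec-mem₂ cs) refl)
consec-unique-left (px ∷ (py ∷ u)) (there here) here = ⊥-elim (All.lookup py (here refl) refl)
consec-unique-left (px ∷ (py ∷ u)) (there (there cs)) here = ⊥-elim (All.lookup py (consec-mem₂ cs) refl)
consec-unique-left (px ∷ u) (there cs) (there cs′) = consec-unique-left u cs cs′

-- b is a common base iff the monomial matrices A⃗₁[b] and A⃗₂[b] have bijective row maps;
-- colU and colV are their inverses.
record BijectiveRows (k m : ℕ) (G : Graph k m) (inS : SourcesHaveInDeg0 G) (outT : SinksHaveOutDeg0 G)
          (b : Fin (k + m) → Fin (|F| G)) : Set where
  field
    rUinj : Injective _≡_ _≡_ (λ j → Incidence.rowU k m G inS outT (b j))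
    rVinj : Injective _≡_ _≡_ (λ j → Incidence.rowV k m G inS outT (b j))
    colU : Fin (k + m) → Fin (k + m)
    rU-colU : ∀ x → Incidence.rowU k m G inS outT (b (colU x)) ≡ x
    colV : Fin (k + m) → Fin (k + m)
    rV-colV : ∀ x → Incidence.rowV k m G inS outT (b (colV x)) ≡ x

opaque
  bijectiveRows : ∀ k m (G : Graph k m) inS outT (b : Fin (k + m) → Fin (|F| G)) →
         det (k + m) (sub (A⃗₁ G) b) ≢ 0ℚ → det (k + m) (sub (A⃗₂ G) b) ≢ 0ℚ → BijectiveRows k m G inS outT b
  bijectiveRows k m G inS outT b nz₁ nz₂ = record
    { rUinj = rUinj ; rVinj = rVinj ; colU = SelfMapInverse.sec n rU rUinj ; rU-colU = SelfMapInverse.f-sec n rU rUinj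
    ; colV = SelfMapInverse.sec n rV rVinj ; rV-colV = SelfMapInverse.f-sec n rV rVinj }
    where
    open Incidence k m G inS outT
    rU : Fin n → Fin n
    rU j = rowU (b j)
    rV : Fin n → Fin n
    rV j = rowV (b j)
    cU : Fin n → ℚ
    cU j = sₑ G (b j)
    subA₁ : ∀ x j → sub (A⃗₁ G) b x j ≡ monomial rU cU x j
    subA₁ x j = A⃗₁-column x (b j)
    subA₂ : ∀ x j → sub (A⃗₂ G) b x j ≡ monomial rV (λ _ → 1ℚ) x j
    subA₂ x j = A⃗₂-column x (b j)
    rUinj : Injective _≡_ _≡_ rU
    rUinj = surjective⇒injective n rU (det-monomial≢0⇒surjective n rU cU (λ e → nz₁ (trans (det-cong n subA₁) e)))
    rVinj : Injective _≡_ _≡_ rV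
    rVinj = surjective⇒injective n rV (det-monomial≢0⇒surjective n rV (λ _ → 1ℚ) (λ e → nz₂ (trans (det-cong n subA₂) e)))

module Successor (k m : ℕ) (G : Graph k m) (inS : SourcesHaveInDeg0 G) (outT : SinksHaveOutDeg0 G)
             (b : Fin (k + m) → Fin (|F| G)) (bd : BijectiveRows k m G inS outT b) where
  open Incidence k m G inS outT public
  open BijectiveRows bd public

  rU : Fin n → Fin n
  rU j = rowU (b j)
  rV : Fin n → Fin n
  rV j = rowV (b j)
  cU : Fin n → ℚ
  cU j = sₑ G (b j)

  subA₁ : ∀ x j → sub (A⃗₁ G) b x j ≡ monomial rU cU x j
  subA₁ x j = A⃗₁-column x (b j)
  subA₂ : ∀ x j → sub (A⃗₂ G) b x j ≡ monomial rV (λ _ → 1ℚ) x j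
  subA₂ x j = A⃗₂-column x (b j)

  colU-rU : ∀ j → colU (rU j) ≡ j
  colU-rU j = rUinj (rU-colU (rU j))
  colU-inj : Injective _≡_ _≡_ colU
  colU-inj {a} {c} e = trans (sym (rU-colU a)) (trans (cong rU e) (rU-colU c))
  outCol : V → Fin N
  outCol v = b (colU (sRow v))

  rowU-outCol : ∀ v → rowU (outCol v) ≡ sRow v
  rowU-outCol v = rU-colU (sRow v)

  -- outCol v is the column of the base in row v_s.  If it is the column of an edge (v, w) then
  -- succ v = w; if it is {v_s, v_t} then succ v = v.
  succVia : V → Fin N → V
  succVia v e = [ eTgt , (λ _ → v) ]′ (splitAt L e)

  succ : V → V
  succ (snk j) = snk j
  succ (src i) = succVia (src i) (outCol (src i))
  succ (mid w) = succVia (mid w) (outCol (mid w))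

  succ-notSink : ∀ v → NotSnk v → succ v ≡ succVia v (outCol v)
  succ-notSink (src i) _ = refl
  succ-notSink (mid w) _ = refl

  UsesEdge : V → Set
  UsesEdge v = Σ (Fin L) λ ℓ → splitAt L (outCol v) ≡ inj₁ ℓ

  module UsesEdgeFacts {v} (ns : NotSnk v) (eo : UsesEdge v) where
    ℓ = proj₁ eo
    eq = proj₂ eo
    src-eq : eSrc ℓ ≡ v
    src-eq = sRow-inj (eSrc-ns ℓ) ns (trans (sym (cong rowUˢ eq)) (rowU-outCol v))
    succ≡target : succ v ≡ eTgt ℓ
    succ≡target = trans (succ-notSink v ns) (cong [ eTgt , (λ _ → v) ]′ eq)
    edge : Edge G v (succ v)
    edge = subst₂ (Edge G) src-eq (sym succ≡target) (edge-mem ℓ)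
    rowV-out : rowV (outCol v) ≡ tRow (succ v)
    rowV-out = trans (cong rowVˢ eq) (cong tRow (sym succ≡target))
    notSrc : NotSrc (succ v)
    notSrc = subst NotSrc (sym succ≡target) (eTgt-ns ℓ)

  usesEdge-src : ∀ i → UsesEdge (src i)
  usesEdge-src i with splitAt L (outCol (src i)) in eq
  ... | inj₁ ℓ = ℓ , refl
  ... | inj₂ w = ⊥-elim (↑ˡ≢↑ʳ i w (sym (trans (sym (cong rowUˢ eq)) (rowU-outCol (src i)))))

  rowV-outCol-injective : ∀ u v → rowV (outCol u) ≡ rowV (outCol v) → sRow u ≡ sRow v
  rowV-outCol-injective u v e = trans (sym (rU-colU (sRow u))) (trans (cong rU (rVinj e)) (rU-colU (sRow v)))

  usesEdge-mid : ∀ {u} w → NotSnk u → UsesEdge u → succ u ≡ mid w → UsesEdge (mid w)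
  usesEdge-mid {u} w ns eo st with splitAt L (outCol (mid w)) in eq
  ... | inj₁ ℓ = ℓ , refl
  ... | inj₂ w″ = ⊥-elim (inj₂≢inj₁ (trans (sym eq) (trans (cong (splitAt L) (cong b (rVinj rv-eq))) (UsesEdgeFacts.eq ns eo))))
    where
    w″≡ : k ↑ʳ w″ ≡ k ↑ʳ w
    w″≡ = trans (sym (cong rowUˢ eq)) (rowU-outCol (mid w))
    rv-eq : rV (colU (sRow (mid w))) ≡ rV (colU (sRow u))
    rv-eq = trans (cong rowVˢ eq) (trans w″≡ (trans (cong tRow (sym st)) (sym (UsesEdgeFacts.rowV-out ns eo))))

  UsesEdgeUnlessSink : V → Set
  UsesEdgeUnlessSink v = NotSnk v → UsesEdge v

  usesEdgeUnlessSink-succ : ∀ u → UsesEdgeUnlessSink u → UsesEdgeUnlessSink (succ u)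
  usesEdgeUnlessSink-succ (snk j) g = g
  usesEdgeUnlessSink-succ u@(src i) g = gs (succ u) refl
    where
    gs : ∀ z → succ u ≡ z → UsesEdgeUnlessSink z
    gs (snk _) e ()
    gs (src _) e _ = ⊥-elim (subst NotSrc e (UsesEdgeFacts.notSrc {u} tt (g tt)))
    gs (mid w) e _ = usesEdge-mid {u} w tt (g tt) e
  usesEdgeUnlessSink-succ u@(mid i) g = gs (succ u) refl
    where
    gs : ∀ z → succ u ≡ z → UsesEdgeUnlessSink z
    gs (snk _) e ()
    gs (src _) e _ = ⊥-elim (subst NotSrc e (UsesEdgeFacts.notSrc {u} tt (g tt)))
    gs (mid w) e _ = usesEdge-mid {u} w tt (g tt) e

  succ-injective : ∀ {u v} → NotSnk u → NotSnk v → UsesEdge u → UsesEdge v → succ u ≡ succ v → u ≡ v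
  succ-injective {u} {v} nu nv eu ev e = sRow-inj nu nv (rowV-outCol-injective u v
    (trans (UsesEdgeFacts.rowV-out nu eu) (trans (cong tRow e) (sym (UsesEdgeFacts.rowV-out nv ev)))))

  iter : ℕ → V → V
  iter zero v = v
  iter (suc t) v = iter t (succ v)

  iter-suc : ∀ t v → iter (suc t) v ≡ succ (iter t v)
  iter-suc zero v = refl
  iter-suc (suc t) v = iter-suc t (succ v)

  iter-+ : ∀ s t v → iter (s + t) v ≡ iter t (iter s v)
  iter-+ zero t v = refl
  iter-+ (suc s) t v = iter-+ s t (succ v)

  usesEdgeUnlessSink-iter : ∀ t v → UsesEdgeUnlessSink v → UsesEdgeUnlessSink (iter t v)
  usesEdgeUnlessSink-iter zero v g = g
  usesEdgeUnlessSink-iter (suc t) v g = usesEdgeUnlessSink-iter t (succ v) (usesEdgeUnlessSink-succ v g)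

  seq : Fin k → ℕ → V
  seq i t = iter t (src i)

  usesEdgeUnlessSink-seq : ∀ i t → UsesEdgeUnlessSink (seq i t)
  usesEdgeUnlessSink-seq i t = usesEdgeUnlessSink-iter t (src i) (λ _ → usesEdge-src i)

  Within : Fin k → ℕ → Set
  Within i p = ∀ t → t < p → NotSnk (seq i t)

  seq-suc : ∀ i t → seq i (suc t) ≡ succ (seq i t)
  seq-suc i t = iter-suc t (src i)

  seq-injective : ∀ a c i i′ → seq i a ≡ seq i′ c → Within i a → Within i′ c → i ≡ i′ × a ≡ c
  seq-injective zero zero i i′ refl _ _ = refl , refl
  seq-injective zero (suc c) i i′ e wa wc = ⊥-elim (subst NotSrc (sym (trans e (seq-suc i′ c)))
             (UsesEdgeFacts.notSrc (wc c ℕP.≤-refl) (usesEdgeUnlessSink-seq i′ c (wc c ℕP.≤-refl))))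
  seq-injective (suc a) zero i i′ e wa wc = ⊥-elim (subst NotSrc (trans (sym (seq-suc i a)) e)
             (UsesEdgeFacts.notSrc (wa a ℕP.≤-refl) (usesEdgeUnlessSink-seq i a (wa a ℕP.≤-refl))))
  seq-injective (suc a) (suc c) i i′ e wa wc with seq-injective a c i i′
         (succ-injective na nc (usesEdgeUnlessSink-seq i a na) (usesEdgeUnlessSink-seq i′ c nc) (trans (sym (seq-suc i a)) (trans e (seq-suc i′ c))))
         (λ t lt → wa t (ℕP.m≤n⇒m≤1+n lt)) (λ t lt → wc t (ℕP.m≤n⇒m≤1+n lt))
    where
    na = wa a ℕP.≤-refl
    nc = wc c ℕP.≤-refl
  ... | e1 , e2 = e1 , cong suc e2

  within-restrict : ∀ {i s t} → Within i t → s ≤ t → Within i s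
  within-restrict w le t lt = w t (ℕP.<-≤-trans lt le)

  within-suc : ∀ {i p} → Within i p → NotSnk (seq i p) → Within i (suc p)
  within-suc {i} {p} w ns t lt with ℕP.m≤n⇒m<n∨m≡n (ℕP.≤-pred lt)
  ... | inj₁ lt′ = w t lt′
  ... | inj₂ refl = ns

  within-bound : ∀ i t → Within i t → t ≤ n
  within-bound i t w with t ℕP.≤? n
  ... | yes le = le
  ... | no nle = ⊥-elim (contra (pigeonhole ℕP.≤-refl g))
    where
    lt : n < t
    lt = ℕP.≰⇒> nle
    g : Fin (suc n) → Fin n
    g x = sRow (seq i (toℕ x))
    nsx : ∀ (x : Fin (suc n)) → NotSnk (seq i (toℕ x))
    nsx x = w (toℕ x) (ℕP.<-≤-trans (toℕ<n x) lt)
    wx : ∀ (x : Fin (suc n)) → Within i (toℕ x)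
    wx x = within-restrict w (ℕP.<⇒≤ (ℕP.<-≤-trans (toℕ<n x) lt))
    contra : (∃ λ x → ∃ λ y → x Fin.< y × g x ≡ g y) → ⊥
    contra (x , y , x<y , e) = ℕP.<-irrefl (proj₂ (seq-injective (toℕ x) (toℕ y) i i (sRow-inj (nsx x) (nsx y) e) (wx x) (wx y))) x<y

  reachesSink : ∀ i → Σ ℕ λ T → (¬ NotSnk (seq i T)) × Within i T
  reachesSink i = aux (suc n) 0 (ℕP.+-identityʳ (suc n)) (λ _ ())
    where
    aux : ∀ f t → f + t ≡ suc n → Within i t → Σ ℕ λ T → (¬ NotSnk (seq i T)) × Within i T
    aux zero t eq w = ⊥-elim (ℕP.<-irrefl refl (subst (_≤ n) eq (within-bound i t w)))
    aux (suc f) t eq w with notSnk? (seq i t)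
    ... | no ¬ns = t , ¬ns , w
    ... | yes ns = aux f (suc t) (trans (ℕP.+-suc f t) eq) w′
      where w′ = within-suc w ns

  mutual
    walkFrom : ℕ → V → List V
    walkFrom f v = v ∷ walkFrom-tail f v

    walkFrom-tail : ℕ → V → List V
    walkFrom-tail zero v = []
    walkFrom-tail (suc f) (snk j) = []
    walkFrom-tail (suc f) (src i) = walkFrom f (succ (src i))
    walkFrom-tail (suc f) (mid w) = walkFrom f (succ (mid w))

  walkFrom-tail-succ : ∀ f v → NotSnk v → walkFrom-tail (suc f) v ≡ walkFrom f (succ v)
  walkFrom-tail-succ f (src i) _ = refl
  walkFrom-tail-succ f (mid w) _ = refl

  walkFrom-tail-sink : ∀ f v → ¬ NotSnk v → walkFrom-tail f v ≡ []
  walkFrom-tail-sink zero v _ = refl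
  walkFrom-tail-sink (suc f) (snk j) _ = refl
  walkFrom-tail-sink (suc f) (src i) ¬ns = ⊥-elim (¬ns tt)
  walkFrom-tail-sink (suc f) (mid w) ¬ns = ⊥-elim (¬ns tt)

  -- d is returned when no sink is reached within f steps.
  sinkIndex : Fin k → ℕ → V → Fin k
  sinkIndex d zero (snk j) = j
  sinkIndex d zero (src _) = d
  sinkIndex d zero (mid _) = d
  sinkIndex d (suc f) (snk j) = j
  sinkIndex d (suc f) (src i) = sinkIndex d f (succ (src i))
  sinkIndex d (suc f) (mid w) = sinkIndex d f (succ (mid w))

  sinkIndex-succ : ∀ d f v → NotSnk v → sinkIndex d (suc f) v ≡ sinkIndex d f (succ v)
  sinkIndex-succ d f (src i) _ = refl
  sinkIndex-succ d f (mid w) _ = refl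

  walkFrom-isWalk : ∀ d T f v → T ≤ f → ¬ NotSnk (iter T v) → (∀ t → t < T → NotSnk (iter t v)) → UsesEdgeUnlessSink v →
              IsWalk G v (snk (sinkIndex d f v)) (walkFrom f v)
  walkFrom-isWalk d zero zero (snk j) le ¬ns pre g = here
  walkFrom-isWalk d zero (suc f) (snk j) le ¬ns pre g = here
  walkFrom-isWalk d zero f (src i) le ¬ns pre g = ⊥-elim (¬ns tt)
  walkFrom-isWalk d zero f (mid w) le ¬ns pre g = ⊥-elim (¬ns tt)
  walkFrom-isWalk d (suc T) (suc f) v (s≤s le) ¬ns pre g =
    subst₂ (λ z l → IsWalk G v (snk z) (v ∷ l)) (sym (sinkIndex-succ d f v ns)) (sym (walkFrom-tail-succ f v ns))
      (IsWalk.step (UsesEdgeFacts.edge ns (g ns)) (walkFrom-isWalk d T f (succ v) le ¬ns (λ t lt → pre (suc t) (s≤s lt)) (usesEdgeUnlessSink-succ v g)))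
    where ns = pre zero (s≤s z≤n)

  walkFrom-∈⁻ : ∀ f v x → x ∈ walkFrom f v → Σ ℕ λ t → t ≤ f × x ≡ iter t v × (∀ t′ → t′ < t → NotSnk (iter t′ v))
  walkFrom-∈⁻ f v x (here refl) = 0 , z≤n , refl , (λ _ ())
  walkFrom-∈⁻ zero v x (there ())
  walkFrom-∈⁻ (suc f) v x (there p) with notSnk? v
  ... | no ¬ns = ⊥-elim (subst (λ l → x ∈ l → ⊥) (sym (walkFrom-tail-sink (suc f) v ¬ns)) (λ ()) p)
  ... | yes ns with walkFrom-∈⁻ f (succ v) x (subst (x ∈_) (walkFrom-tail-succ f v ns) p)
  ...   | t , le , e , pre = suc t , s≤s le , e , pre′
    where
    pre′ : ∀ t′ → t′ < suc t → NotSnk (iter t′ v)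
    pre′ zero _ = ns
    pre′ (suc t′) (s≤s lt) = pre t′ lt

  walkFrom-∈⁺ : ∀ t f v → t ≤ f → (∀ t′ → t′ < t → NotSnk (iter t′ v)) → iter t v ∈ walkFrom f v
  walkFrom-∈⁺ zero f v le pre = here refl
  walkFrom-∈⁺ (suc t) (suc f) v (s≤s le) pre =
    there (subst (iter t (succ v) ∈_) (sym (walkFrom-tail-succ f v (pre zero (s≤s z≤n)))) (walkFrom-∈⁺ t f (succ v) le (λ t′ lt → pre (suc t′) (s≤s lt))))

  walkFrom-consec⁻ : ∀ f v a c → Consec (walkFrom f v) a c → NotSnk a × c ≡ succ a × a ∈ walkFrom f v
  walkFrom-consec⁻ zero v a c (there ())
  walkFrom-consec⁻ (suc f) v a c cs with notSnk? v
  ... | no ¬ns = ⊥-elim (helper (subst (λ l → Consec (v ∷ l) a c) (walkFrom-tail-sink (suc f) v ¬ns) cs))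
    where
    helper : Consec (v ∷ []) a c → ⊥
    helper (there ())
  ... | yes ns with subst (λ l → Consec (v ∷ l) a c) (walkFrom-tail-succ f v ns) cs
  ...   | here = ns , refl , here refl
  ...   | there cs′ with walkFrom-consec⁻ f (succ v) a c cs′
  ...     | na , e , mem = na , e , there (subst (a ∈_) (sym (walkFrom-tail-succ f v ns)) mem)

  walkFrom-consec⁺ : ∀ t f v → t < f → (∀ t′ → t′ ≤ t → NotSnk (iter t′ v)) → Consec (walkFrom f v) (iter t v) (succ (iter t v))
  walkFrom-consec⁺ zero (suc f) v lt pre = subst (λ l → Consec (v ∷ l) v (succ v)) (sym (walkFrom-tail-succ f v (pre zero z≤n))) here
  walkFrom-consec⁺ (suc t) (suc f) v (s≤s lt) pre = subst (λ l → Consec (v ∷ l) (iter t (succ v)) (succ (iter t (succ v))))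
    (sym (walkFrom-tail-succ f v (pre zero z≤n))) (there (walkFrom-consec⁺ t f (succ v) lt (λ t′ le → pre (suc t′) (s≤s le))))

  withinExt : ∀ i q t → Within i q → (∀ s → s < t → NotSnk (iter s (seq i q))) → Within i (q + t)
  withinExt i q t w pre t″ lt with t″ ℕP.<? q
  ... | yes lt′ = w t″ lt′
  ... | no nlt = subst (λ z → NotSnk (seq i z)) (ℕP.m+[n∸m]≡n q≤) (subst NotSnk (sym (iter-+ q (t″ ℕ.∸ q) (src i)))
                   (pre (t″ ℕ.∸ q) (subst (t″ ℕ.∸ q <_) (ℕP.m+n∸m≡n q t) (ℕP.∸-monoˡ-< lt q≤))))
    where q≤ = ℕP.≮⇒≥ nlt

  walkFrom-unique : ∀ f i p → Within i p → Unique (walkFrom f (seq i p))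
  walkFrom-unique zero i p w = [] ∷ []
  walkFrom-unique (suc f) i p w with notSnk? (seq i p)
  ... | no ¬ns = subst (λ l → Unique (seq i p ∷ l)) (sym (walkFrom-tail-sink (suc f) (seq i p) ¬ns)) ([] ∷ [])
  ... | yes ns = subst (λ l → Unique (seq i p ∷ l)) (sym (trans (walkFrom-tail-succ f (seq i p) ns) (cong (walkFrom f) (sym (seq-suc i p)))))
                   (All.tabulate allp ∷ walkFrom-unique f i (suc p) w′)
    where
    w′ = within-suc w ns
    allp : ∀ {x} → x ∈ walkFrom f (seq i (suc p)) → seq i p ≢ x
    allp {x} mem e with walkFrom-∈⁻ f (seq i (suc p)) x mem
    ... | t , _ , ex , pre = ℕP.<-irrefl (proj₂ (seq-injective p (suc p + t) i i
            (trans e (trans ex (sym (iter-+ (suc p) t (src i))))) w (withinExt i (suc p) t w′ pre)))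
            (ℕP.m≤m+n (suc p) t)

  walk-last∈ : ∀ {u v xs} → IsWalk G u v xs → v ∈ xs
  walk-last∈ here = here refl
  walk-last∈ (IsWalk.step _ w) = there (walk-last∈ w)

  module BasePaths where
    sinkTime : Fin k → ℕ
    sinkTime i = proj₁ (reachesSink i)
    pathFrom : Fin k → List V
    pathFrom i = walkFrom n (src i)
    sinkPerm : Fin k → Fin k
    sinkPerm i = sinkIndex i n (src i)
    pathFrom-isWalk : ∀ i → IsWalk G (src i) (snk (sinkPerm i)) (pathFrom i)
    pathFrom-isWalk i = walkFrom-isWalk i (sinkTime i) n (src i) (within-bound i (sinkTime i) (proj₂ (proj₂ (reachesSink i))))
                  (proj₁ (proj₂ (reachesSink i))) (proj₂ (proj₂ (reachesSink i))) (λ _ → usesEdge-src i)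
    pathFrom-unique : ∀ i → Unique (pathFrom i)
    pathFrom-unique i = walkFrom-unique n i 0 (λ _ ())
    pathFrom-disjoint : ∀ i j → i ≢ j → ∀ x → x ∈ pathFrom i → x ∈ pathFrom j → ⊥
    pathFrom-disjoint i j ne x p q with walkFrom-∈⁻ n (src i) x p | walkFrom-∈⁻ n (src j) x q
    ... | t , _ , e , pre | t′ , _ , e′ , pre′ = ne (proj₁ (seq-injective t t′ i j (trans (sym e) e′) pre pre′))
    sinkPerm-injective : Injective _≡_ _≡_ sinkPerm
    sinkPerm-injective {i} {j} e with i Fin.≟ j
    ... | yes eq = eq
    ... | no ne = ⊥-elim (pathFrom-disjoint i j ne (snk (sinkPerm i)) (walk-last∈ (pathFrom-isWalk i)) (subst (λ z → snk z ∈ pathFrom j) (sym e) (walk-last∈ (pathFrom-isWalk j))))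
    open SelfMapInverse k sinkPerm sinkPerm-injective using (sec; f-sec; sec-f)
    sinkPermutation : Permutation′ k
    sinkPermutation = permutation sinkPerm sec f-sec sec-f
    paths : DisjointPaths G
    paths = record { σ = sinkPermutation ; path = pathFrom ; isPath = λ i → pathFrom-isWalk i , pathFrom-unique i ; disjoint = pathFrom-disjoint }

module Covering (k m : ℕ) (G : Graph k m) (acyclic : IsAcyclic G) (inS : SourcesHaveInDeg0 G) (outT : SinksHaveOutDeg0 G)
            (b : Fin (k + m) → Fin (|F| G)) (bd : BijectiveRows k m G inS outT b) where
  open Successor k m G inS outT b bd public

  OnPath : V → Set
  OnPath v = Σ (Fin k) λ i → Σ ℕ λ p → seq i p ≡ v × Within i p

  predecessor : ∀ w → UsesEdge (mid w) → Σ V λ u → NotSnk u × UsesEdge u × succ u ≡ mid w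
  predecessor w eo with splitAt L (b (colV (k ↑ʳ w))) in eq
  ... | inj₂ w″ = ⊥-elim (inj₂≢inj₁ (trans (sym eq) (trans (cong (λ z → splitAt L (b z)) c≡) (proj₂ eo))))
    where
    c = colV (k ↑ʳ w)
    rUc : rU c ≡ sRow (mid w)
    rUc = trans (cong rowUˢ eq)
           (trans (sym (cong rowVˢ eq)) (rV-colV (k ↑ʳ w)))
    c≡ : c ≡ colU (sRow (mid w))
    c≡ = trans (sym (colU-rU c)) (cong colU rUc)
  ... | inj₁ ℓ = eSrc ℓ , eSrc-ns ℓ , eoU , trans (UsesEdgeFacts.succ≡target (eSrc-ns ℓ) eoU) tgt≡
    where
    c = colV (k ↑ʳ w)
    c≡ : c ≡ colU (sRow (eSrc ℓ))
    c≡ = trans (sym (colU-rU c)) (cong colU (cong rowUˢ eq))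
    eoU : UsesEdge (eSrc ℓ)
    eoU = ℓ , trans (cong (λ z → splitAt L (b z)) (sym c≡)) eq
    tgt≡ : eTgt ℓ ≡ mid w
    tgt≡ = tRow-inj (eTgt-ns ℓ) tt (trans (sym (cong rowVˢ eq)) (rV-colV (k ↑ʳ w)))

  BackChain : ℕ → V → Set
  BackChain t v = Σ (ℕ → V) λ f → f 0 ≡ v × (∀ s → s < t → Edge G (f (suc s)) (f s)) × (∀ s → s ≤ t → NotSnk (f s))

  onPath-succ : ∀ {u} → OnPath u → NotSnk u → OnPath (succ u)
  onPath-succ (i , p , e , w) ns = i , suc p , trans (seq-suc i p) (cong succ e) , w′
    where w′ = within-suc w (subst NotSnk (sym e) ns)

  chase : ∀ t w → UsesEdge (mid w) → OnPath (mid w) ⊎ BackChain t (mid w)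
  chase zero w eo = inj₂ ((λ _ → mid w) , refl , (λ _ ()) , (λ _ _ → tt))
  chase (suc t) w eo with predecessor w eo
  ... | snk _ , () , _
  ... | src i , _ , eoU , e = inj₁ (i , 1 , e , (λ { zero _ → tt ; (suc _) (s≤s ()) }))
  ... | mid w′ , _ , eoU , e with chase t w′ eoU
  ...   | inj₁ op = inj₁ (subst OnPath e (onPath-succ op tt))
  ...   | inj₂ (f , f0 , edges , nss) = inj₂ (f′ , refl , edges′ , nss′)
    where
    f′ : ℕ → V
    f′ zero = mid w
    f′ (suc s) = f s
    edges′ : ∀ s → s < suc t → Edge G (f′ (suc s)) (f′ s)
    edges′ zero _ = subst₂ (Edge G) (sym f0) e (UsesEdgeFacts.edge tt eoU)
    edges′ (suc s) (s≤s lt) = edges s lt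
    nss′ : ∀ s → s ≤ suc t → NotSnk (f′ s)
    nss′ zero _ = tt
    nss′ (suc s) (s≤s le) = nss s le

  back-tc : ∀ (f : ℕ → V) t → (∀ s → s < t → Edge G (f (suc s)) (f s)) → ∀ a d → suc (d + a) ≤ t →
            TransClosure (Edge G) (f (suc (d + a))) (f a)
  back-tc f t edges a zero le = [ edges a le ]
  back-tc f t edges a (suc d) le = edges (suc (d + a)) le ∷ back-tc f t edges a d (ℕP.≤-trans (ℕP.n≤1+n _) le)

  noBackChain : ∀ v → ¬ BackChain n v
  noBackChain v (f , _ , edges , nss) with pigeonhole ℕP.≤-refl (λ (x : Fin (suc n)) → sRow (f (toℕ x)))
  ... | x , y , x<y , e = acyclic (f (toℕ x)) (subst (λ z → TransClosure (Edge G) z (f (toℕ x))) fy≡fx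
         (subst (λ z → TransClosure (Edge G) (f z) (f (toℕ x))) dy (back-tc f n edges (toℕ x) d le)))
    where
    d = toℕ y ℕ.∸ suc (toℕ x)
    dy : suc (d + toℕ x) ≡ toℕ y
    dy = trans (cong suc (ℕP.+-comm d (toℕ x))) (ℕP.m+[n∸m]≡n x<y)
    le : suc (d + toℕ x) ≤ n
    le = subst (_≤ n) (sym dy) (ℕP.≤-pred (toℕ<n y))
    fy≡fx : f (toℕ y) ≡ f (toℕ x)
    fy≡fx = sym (sRow-inj (nss (toℕ x) (ℕP.≤-pred (toℕ<n x))) (nss (toℕ y) (ℕP.≤-pred (toℕ<n y))) e)

  -- Following predecessors back from a moved inner vertex either reaches a source or, after n
  -- steps, repeats a vertex, which would close a cycle in G.
  usesEdge⇒onPath : ∀ w → UsesEdge (mid w) → OnPath (mid w)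
  usesEdge⇒onPath w eo with chase n w eo
  ... | inj₁ op = op
  ... | inj₂ bc = ⊥-elim (noBackChain (mid w) bc)

module BaseSign (k m : ℕ) (G : Graph k m) (acyclic : IsAcyclic G) (inS : SourcesHaveInDeg0 G) (outT : SinksHaveOutDeg0 G)
            (b : Fin (k + m) → Fin (|F| G)) (bd : BijectiveRows k m G inS outT b) where
  open Covering k m G acyclic inS outT b bd public
  open BasePaths public
  module L = ChainContraction k m
  open L using (Chain; done; next; Inner; weight; #movedInner; movedInner)

  -- π sends the V_S-row of each column of the base to its V_T-row.
  π : Fin n → Fin n
  π x = rV (colU x)
  π-injective : Injective _≡_ _≡_ π
  π-injective e = colU-inj (rVinj e)
  π⁻¹ : Fin n → Fin n
  π⁻¹ y = rU (colV y)
  π-π⁻¹ : ∀ y → π (π⁻¹ y) ≡ y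
  π-π⁻¹ y = trans (cong rV (colU-rU (colV y))) (rV-colV y)

  sinkIndex-sink : ∀ d f j → sinkIndex d f (snk j) ≡ j
  sinkIndex-sink d zero j = refl
  sinkIndex-sink d (suc f) j = refl

  chainFrom : ∀ d T f v → T ≤ f → ¬ NotSnk (iter T v) → (∀ t → t < T → NotSnk (iter t v)) → UsesEdgeUnlessSink v → NotSnk v →
            Chain π (sRow v) (sinkIndex d f v)
  chainFrom d zero f v le ¬ns pre g ns = ⊥-elim (¬ns ns)
  chainFrom d (suc T) (suc f) v (s≤s le) ¬ns pre g ns = subst (Chain π (sRow v)) (sym (sinkIndex-succ d f v ns)) (go (succ v) refl)
    where
    eo = g ns
    go : ∀ z → succ v ≡ z → Chain π (sRow v) (sinkIndex d f (succ v))
    go (snk j) e = done (trans (UsesEdgeFacts.rowV-out ns eo) (trans (cong tRow e) (cong (_↑ˡ m) (sym (trans (cong (sinkIndex d f) e) (sinkIndex-sink d f j))))))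
    go (src i) e = ⊥-elim (subst NotSrc e (UsesEdgeFacts.notSrc ns eo))
    go (mid w) e = next (subst Inner (sym (trans πeq (cong sRow e))) (L.inner-↑ʳ w))
                     (subst (λ z → Chain π z (sinkIndex d f (succ v))) (sym πeq)
                         (chainFrom d T f (succ v) le ¬ns (λ t lt → pre (suc t) (s≤s lt)) (usesEdgeUnlessSink-succ v g) (subst NotSnk (sym e) tt)))
      where
      πeq : π (sRow v) ≡ sRow (succ v)
      πeq = trans (UsesEdgeFacts.rowV-out ns eo) (trans (cong tRow e) (cong sRow (sym e)))

  chains : ∀ i → Chain π (i ↑ˡ m) (sinkPerm i)
  chains i = chainFrom i (sinkTime i) n (src i) (within-bound i (sinkTime i) (proj₂ (proj₂ (reachesSink i))))
               (proj₁ (proj₂ (reachesSink i))) (proj₂ (proj₂ (reachesSink i))) (λ _ → usesEdge-src i) tt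

  Within? : ∀ i p → Dec (Within i p)
  Within? i zero = yes (λ _ ())
  Within? i (suc p) with Within? i p | notSnk? (seq i p)
  ... | no ¬w | _ = no (λ w → ¬w (within-restrict w (ℕP.n≤1+n p)))
  ... | yes _ | no ¬ns = no (λ w → ¬ns (w p ℕP.≤-refl))
  ... | yes w | yes ns = yes w′
    where
    w′ = within-suc w ns

  Pos : Fin n → Fin k → Fin (suc n) → Set
  Pos x i t = (seq i (toℕ t) ≡ vtxOf x) × Within i (toℕ t)

  pos? : ∀ x → Dec (∃ λ i → ∃ λ t → Pos x i t)
  pos? x = any? (λ i → any? (λ t → (seq i (toℕ t) ≟V vtxOf x) ×-dec Within? i (toℕ t)))

  -- The position of x on its path, and 0 off the paths.
  depth : Fin n → ℕ
  depth x with pos? x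
  ... | yes (_ , t , _) = toℕ t
  ... | no _ = 0

  depth-seq : ∀ i p → Within i p → p ≤ n → NotSnk (seq i p) → depth (sRow (seq i p)) ≡ p
  depth-seq i p w le ns with pos? (sRow (seq i p))
  ... | yes (i′ , t , e , w′) = proj₂ (seq-injective (toℕ t) p i′ i (trans e (vtxOf-sRow (seq i p) ns)) w′ w)
  ... | no ¬p = ⊥-elim (¬p (i , fromℕ< (s≤s le) , subst (λ z → seq i z ≡ vtxOf (sRow (seq i p))) (sym (toℕ-fromℕ< (s≤s le))) (sym (vtxOf-sRow (seq i p) ns)) ,
                         subst (Within i) (sym (toℕ-fromℕ< (s≤s le))) w))

  inner-mid : ∀ x → Inner x → Σ (Fin m) λ w → x ≡ k ↑ʳ w
  inner-mid x inn with splitAt k x in eq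
  ... | inj₂ w = w , trans (sym (join-splitAt k m x)) (cong (join k m) eq)
  ... | inj₁ i = ⊥-elim (L.↑ˡ≢inner i x inn (sym (trans (sym (join-splitAt k m x)) (cong (join k m) eq))))

  usesEdge-moved : ∀ w → π (k ↑ʳ w) ≢ k ↑ʳ w → UsesEdge (mid w)
  usesEdge-moved w ne with splitAt L (outCol (mid w)) in eq
  ... | inj₁ ℓ = ℓ , refl
  ... | inj₂ w″ = ⊥-elim (ne (trans (sym (cong rowUˢ eq)) (rowU-outCol (mid w))))

  depth-increases : ∀ x → Inner x → π x ≢ x → Inner (π x) → depth x < depth (π x)
  depth-increases x inn ne inn′ with inner-mid x inn
  ... | w , refl with usesEdge⇒onPath w (usesEdge-moved w ne)
  ...   | i , p , e , wi = subst₂ _<_ (sym d1) (sym d2) ℕP.≤-refl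
    where
    eo = usesEdge-moved w ne
    nsp : NotSnk (seq i p)
    nsp = subst NotSnk (sym e) tt
    wi′ = within-suc wi nsp
    πx : π (k ↑ʳ w) ≡ tRow (seq i (suc p))
    πx = trans (UsesEdgeFacts.rowV-out {mid w} tt eo) (cong tRow (trans (cong succ (sym e)) (sym (seq-suc i p))))
    nsq : NotSnk (seq i (suc p))
    nsq with seq i (suc p) in eq2
    ... | snk j = ⊥-elim (L.↑ˡ≢inner j (π (k ↑ʳ w)) inn′ (sym (trans πx (cong tRow eq2))))
    ... | src _ = tt
    ... | mid _ = tt
    tRow≡sRow : ∀ v → NotSnk v → NotSrc v → tRow v ≡ sRow v
    tRow≡sRow (mid _) _ _ = refl
    nsrcq : NotSrc (seq i (suc p))
    nsrcq = subst NotSrc (sym (seq-suc i p)) (UsesEdgeFacts.notSrc nsp (usesEdgeUnlessSink-seq i p nsp))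
    d1 : depth (k ↑ʳ w) ≡ p
    d1 = subst (λ z → depth (sRow z) ≡ p) e (depth-seq i p wi (ℕP.≤-trans (ℕP.n≤1+n p) (within-bound i (suc p) wi′)) nsp)
    d2 : depth (π (k ↑ʳ w)) ≡ suc p
    d2 = trans (cong depth (trans πx (tRow≡sRow _ nsq nsrcq))) (depth-seq i (suc p) wi′ (within-bound i (suc p) wi′) nsq)

  weight-cases : ∀ x {a c} → (toℕ x <ᵇ k) ≡ a → does (π x Fin.≟ x) ≡ c → weight π x ≡ (if a ∨ not c then - 1ℚ else 1ℚ)
  weight-cases x e1 e2 = cong₂ (λ a c → if a ∨ not c then - 1ℚ else 1ℚ) e1 e2

  weight-F₂ : ∀ x w → splitAt L (b (colU x)) ≡ inj₂ w → 1ℚ ≡ weight π x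
  weight-F₂ x w eq = sym (weight-cases x (≤⇒<ᵇ-false xinner) (dec-true (π x Fin.≟ x) πx≡x))
    where
    x≡ : x ≡ k ↑ʳ w
    x≡ = trans (sym (rU-colU x)) (cong rowUˢ eq)
    πx≡x : π x ≡ x
    πx≡x = trans (cong rowVˢ eq) (sym x≡)
    xinner : k ≤ toℕ x
    xinner = subst Inner (sym x≡) (L.inner-↑ʳ w)

  weight-F₁ : ∀ x ℓ → splitAt L (b (colU x)) ≡ inj₁ ℓ → - 1ℚ ≡ weight π x
  weight-F₁ x ℓ eq with toℕ x <ᵇ k in eqk
  ... | true = refl
  ... | false = sym (cong (λ c → if false ∨ not c then - 1ℚ else 1ℚ) (dec-false (π x Fin.≟ x) noloop))
    where
    x≡ : x ≡ sRow (eSrc ℓ)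
    x≡ = trans (sym (rU-colU x)) (cong rowUˢ eq)
    πx≡ : π x ≡ tRow (eTgt ℓ)
    πx≡ = cong rowVˢ eq
    notlt : ¬ (toℕ x < k)
    notlt lt = t≢f (trans (sym (<⇒<ᵇ-true lt)) eqk)
      where
      t≢f : true ≢ false
      t≢f ()
    -- π x = x would make the edge ℓ a loop.
    noloop : π x ≢ x
    noloop e = helper (eSrc ℓ) (eTgt ℓ) refl refl
      where
      helper : ∀ u v → eSrc ℓ ≡ u → eTgt ℓ ≡ v → ⊥
      helper (src i) v e1 _ = notlt (subst (λ z → toℕ z < k) (sym (trans x≡ (cong sRow e1))) (L.src<k i))
      helper (snk j) v e1 _ = subst NotSnk e1 (eSrc-ns ℓ)
      helper (mid w1) (src i) _ e2 = subst NotSrc e2 (eTgt-ns ℓ)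
      helper (mid w1) (snk j) e1 e2 = notlt (subst (λ z → toℕ z < k) (sym (trans (sym e) (trans πx≡ (cong tRow e2)))) (L.src<k j))
      helper (mid w1) (mid w2) e1 e2 = acyclic (mid w1) [ subst₂ (Edge G) e1 (trans e2 (cong mid w21)) (edge-mem ℓ) ]
        where
        w21 : w2 ≡ w1
        w21 = FinP.↑ʳ-injective k w2 w1 (trans (sym (trans πx≡ (cong tRow e2))) (trans e (trans x≡ (cong sRow e1))))

  sₑ-F₁ : ∀ e ℓ → splitAt L e ≡ inj₁ ℓ → sₑ G e ≡ - 1ℚ
  sₑ-F₁ e ℓ eq rewrite eq = refl

  sₑ-F₂ : ∀ e w → splitAt L e ≡ inj₂ w → sₑ G e ≡ 1ℚ
  sₑ-F₂ e w eq rewrite eq = refl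

  sₑ≡weight : ∀ x → cU (colU x) ≡ weight π x
  sₑ≡weight x = helper (splitAt L (b (colU x))) refl
    where
    helper : (s : Fin L ⊎ Fin m) → splitAt L (b (colU x)) ≡ s → cU (colU x) ≡ weight π x
    helper (inj₁ ℓ) eq = trans (sₑ-F₁ _ ℓ eq) (weight-F₁ x ℓ eq)
    helper (inj₂ w) eq = trans (sₑ-F₂ _ w eq) (weight-F₂ x w eq)

  chainSystem : L.ChainSystem sinkPerm
  chainSystem = record { π = π ; π⁻¹ = π⁻¹ ; π-π⁻¹ = π-π⁻¹ ; π-injective = π-injective ; chain = chains
                       ; depth = depth ; depth-< = depth-increases }

  det*det≡sign : det n (sub (A⃗₁ G) b) * det n (sub (A⃗₂ G) b) ≡ sgnℕ k * sgnF k sinkPerm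
  det*det≡sign = begin
    det n (sub (A⃗₁ G) b) * det n (sub (A⃗₂ G) b)
      ≡⟨ cong₂ _*_ (trans (det-cong n subA₁) (det-monomial n rU cU rUinj)) (trans (det-cong n subA₂) (det-monomial n rV (λ _ → 1ℚ) rVinj)) ⟩
    (sgnF n rU * Πq n cU) * (sgnF n rV * Πq n (λ _ → 1ℚ))
      ≡⟨ cong₂ (λ a c → (sgnF n rU * a) * (c * Πq n (λ _ → 1ℚ))) Peq sVeq ⟩
    (sgnF n rU * Πq n (weight π)) * ((sgnF n π * sgnF n rU) * Πq n (λ _ → 1ℚ))
      ≡⟨ cong (λ z → (sgnF n rU * Πq n (weight π)) * ((sgnF n π * sgnF n rU) * z)) (Πq-1 n) ⟩
    (sgnF n rU * Πq n (weight π)) * ((sgnF n π * sgnF n rU) * 1ℚ)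
      ≡⟨ solve 3 (λ R P S → (R ⊕ P) ⊕ ((S ⊕ R) ⊕ ι) ⊜ (S ⊕ P) ⊕ (R ⊕ R)) refl (sgnF n rU) (Πq n (weight π)) (sgnF n π) ⟩
    (sgnF n π * Πq n (weight π)) * (sgnF n rU * sgnF n rU)
      ≡⟨ cong ((sgnF n π * Πq n (weight π)) *_) (sgnℕ-sq (inversions n rU)) ⟩
    (sgnF n π * Πq n (weight π)) * 1ℚ
      ≡⟨ ℚP.*-identityʳ _ ⟩
    sgnF n π * Πq n (weight π)
      ≡⟨ L.sign-of-chains chainSystem ⟩
    sgnℕ k * sgnF k sinkPerm ∎
    where
    open ≡-Reasoning
    Peq : Πq n cU ≡ Πq n (weight π)
    Peq = trans (sym (Πq-reindex n cU colU colU-inj)) (Πq-cong n sₑ≡weight)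
    sVeq : sgnF n rV ≡ sgnF n π * sgnF n rU
    sVeq = trans (sgnF-cong n (λ j → sym (cong rV (colU-rU j)))) (sgnF-comp n π rU π-injective rUinj)

strict⇒injective : ∀ {r M} (b : Fin r → Fin M) → StrictlyIncreasing b → Injective _≡_ _≡_ b
strict⇒injective b si {x} {y} e with ℕP.<-cmp (toℕ x) (toℕ y)
... | tri< lt _ _ = ⊥-elim (ℕP.<-irrefl (cong toℕ e) (si x y lt))
... | tri≈ _ eq _ = toℕ-injective eq
... | tri> _ _ gt = ⊥-elim (ℕP.<-irrefl (cong toℕ (sym e)) (si y x gt))

#below-index : ∀ r (j : Fin r) → Σn r (λ y → ind (toℕ y <ᵇ toℕ j)) ≡ toℕ j
#below-index (suc r) zero = Σn-0 r (λ y → refl)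
#below-index (suc r) (suc j) = cong suc (#below-index r j)

#below : ∀ {r M} → (Fin r → Fin M) → Fin M → ℕ
#below {r} b e = Σn r (λ y → ind (toℕ (b y) <ᵇ toℕ e))

#below-strict : ∀ {r M} (b : Fin r → Fin M) → StrictlyIncreasing b → ∀ j → #below b (b j) ≡ toℕ j
#below-strict {r} b si j = trans (Σn-cong r pw) (#below-index r j)
  where
  pw : ∀ y → ind (toℕ (b y) <ᵇ toℕ (b j)) ≡ ind (toℕ y <ᵇ toℕ j)
  pw y with ℕP.<-cmp (toℕ y) (toℕ j)
  ... | tri< lt _ _ rewrite <⇒<ᵇ-true lt | <⇒<ᵇ-true (si y j lt) = refl
  ... | tri≈ _ eq _ rewrite toℕ-injective eq | <ᵇ-irrefl (toℕ j) | <ᵇ-irrefl (toℕ (b j)) = refl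
  ... | tri> _ _ gt rewrite ≤⇒<ᵇ-false (ℕP.<⇒≤ gt) | ≤⇒<ᵇ-false (ℕP.<⇒≤ (si j y gt)) = refl

strict-unique : ∀ {r M} (b b′ : Fin r → Fin M) → StrictlyIncreasing b → StrictlyIncreasing b′ →
              (∀ j → ∃ λ j′ → b j ≡ b′ j′) → ∀ j → b j ≡ b′ j
strict-unique {r} b b′ si si′ incl j = trans (proj₂ (incl j)) (cong b′ (sym jj))
  where
  h : Fin r → Fin r
  h y = proj₁ (incl y)
  hinj : Injective _≡_ _≡_ h
  hinj {x} {y} e = strict⇒injective b si (trans (proj₂ (incl x)) (trans (cong b′ e) (sym (proj₂ (incl y)))))
  cnt-eq : ∀ e → #below b e ≡ #below b′ e
  cnt-eq e = trans (Σn-cong r (λ y → cong (λ z → ind (toℕ z <ᵇ toℕ e)) (proj₂ (incl y))))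
                   (Σn-reindex r (λ z → ind (toℕ (b′ z) <ᵇ toℕ e)) h hinj)
  jj : j ≡ proj₁ (incl j)
  jj = toℕ-injective (trans (sym (#below-strict b si j)) (trans (cnt-eq (b j))
          (trans (cong (#below b′) (proj₂ (incl j))) (#below-strict b′ si′ (proj₁ (incl j))))))


Σn-mono : ∀ N (f g : Fin N → ℕ) → (∀ x → f x ≤ g x) → Σn N f ≤ Σn N g
Σn-mono zero f g h = z≤n
Σn-mono (suc N) f g h = ℕP.+-mono-≤ (h zero) (Σn-mono N (λ x → f (suc x)) (λ x → g (suc x)) (λ x → h (suc x)))

Σn-≤N : ∀ N (f : Fin N → ℕ) → (∀ x → f x ≤ 1) → Σn N f ≤ N
Σn-≤N zero f h = z≤n
Σn-≤N (suc N) f h = ℕP.+-mono-≤ (h zero) (Σn-≤N N (λ x → f (suc x)) (λ x → h (suc x)))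

ind≤1 : ∀ b → ind b ≤ 1
ind≤1 true = ℕP.≤-refl
ind≤1 false = z≤n

<ᵇ-trans-ind : ∀ a b c → b < c → ind (a <ᵇ b) ≤ ind (a <ᵇ c)
<ᵇ-trans-ind a b c bc with a ℕP.<? b
... | yes ab rewrite <⇒<ᵇ-true ab | <⇒<ᵇ-true (ℕP.<-trans ab bc) = ℕP.≤-refl
... | no nab rewrite ≤⇒<ᵇ-false (ℕP.≮⇒≥ nab) = z≤n

Σn-<N : ∀ {r} (f : Fin r → ℕ) x → f x ≡ 0 → (∀ y → f y ≤ 1) → Σn r f < r
Σn-<N {suc r} f x e h =
  subst (_< suc r) (sym (Σn-punchIn r f x))
    (subst (λ z → z + Σn r (λ i → f (punchIn x i)) < suc r) (sym e) (s≤s (Σn-≤N r (λ i → f (punchIn x i)) (λ y → h (punchIn x y)))))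

Σn-strict : ∀ {r} (f g : Fin r → ℕ) x → (∀ y → f y ≤ g y) → f x < g x → Σn r f < Σn r g
Σn-strict {suc r} f g x h lt = subst₂ _<_ (sym (Σn-punchIn r f x)) (sym (Σn-punchIn r g x))
   (ℕP.+-mono-<-≤ lt (Σn-mono r (λ i → f (punchIn x i)) (λ i → g (punchIn x i)) (λ y → h (punchIn x y))))

module Sort {r M} (g : Fin r → Fin M) (ginj : Injective _≡_ _≡_ g) where
  rank : Fin r → ℕ
  rank x = Σn r (λ y → ind (toℕ (g y) <ᵇ toℕ (g x)))

  rank< : ∀ x → rank x < r
  rank< x = Σn-<N (λ y → ind (toℕ (g y) <ᵇ toℕ (g x))) x (cong ind (<ᵇ-irrefl (toℕ (g x)))) (λ y → ind≤1 _)

  rank-mono : ∀ x y → toℕ (g x) < toℕ (g y) → rank x < rank y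
  rank-mono x y lt = Σn-strict (λ z → ind (toℕ (g z) <ᵇ toℕ (g x))) (λ z → ind (toℕ (g z) <ᵇ toℕ (g y))) x
     (λ z → <ᵇ-trans-ind (toℕ (g z)) (toℕ (g x)) (toℕ (g y)) lt)
     (subst₂ _<_ (sym (cong ind (<ᵇ-irrefl (toℕ (g x))))) (sym (cong ind (<⇒<ᵇ-true lt))) (s≤s z≤n))

  rankF : Fin r → Fin r
  rankF x = fromℕ< (rank< x)

  toℕ-rankF : ∀ x → toℕ (rankF x) ≡ rank x
  toℕ-rankF x = toℕ-fromℕ< (rank< x)

  rankF-inj : Injective _≡_ _≡_ rankF
  rankF-inj {x} {y} e with ℕP.<-cmp (toℕ (g x)) (toℕ (g y))
  ... | tri< lt _ _ = ⊥-elim (ℕP.<-irrefl (trans (sym (toℕ-rankF x)) (trans (cong toℕ e) (toℕ-rankF y))) (rank-mono x y lt))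
  ... | tri≈ _ eq _ = ginj (toℕ-injective eq)
  ... | tri> _ _ gt = ⊥-elim (ℕP.<-irrefl (trans (sym (toℕ-rankF y)) (trans (cong toℕ (sym e)) (toℕ-rankF x))) (rank-mono y x gt))

  open SelfMapInverse r rankF rankF-inj public using () renaming (sec to rinv; f-sec to rank-rinv; sec-f to rinv-rank; sec-inj to rinv-inj)

  sorted : Fin r → Fin M
  sorted j = g (rinv j)

  sorted-sinc : StrictlyIncreasing sorted
  sorted-sinc i j i<j with ℕP.<-cmp (toℕ (g (rinv i))) (toℕ (g (rinv j)))
  ... | tri< lt _ _ = lt
  ... | tri≈ _ eq _ = ⊥-elim (ℕP.<-irrefl (cong toℕ (rinv-inj (ginj (toℕ-injective eq)))) i<j)
  ... | tri> _ _ gt = ⊥-elim (ℕP.<-asym i<j (subst₂ _<_ eqj eqi (rank-mono (rinv j) (rinv i) gt)))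
    where
    eqj : rank (rinv j) ≡ toℕ j
    eqj = trans (sym (toℕ-rankF (rinv j))) (cong toℕ (rank-rinv j))
    eqi : rank (rinv i) ≡ toℕ i
    eqi = trans (sym (toℕ-rankF (rinv i))) (cong toℕ (rank-rinv i))

-- Paths determine the columns of a base

-- The columns called for by a family of paths: the edge ℓ when it joins consecutive vertices of
-- a path, and {(v_w)_s, (v_w)_t} when v_w lies on no path.
ColumnOfS : ∀ {k m} (G : Graph k m) → (Fin k → List (Vtx k m)) → Fin (length (edges G)) ⊎ Fin m → Set
ColumnOfS {k} G ps = [ (λ ℓ → Σ (Fin k) λ i → Consec (ps i) (proj₁ (lookup (edges G) ℓ)) (proj₂ (lookup (edges G) ℓ))) ,
                     (λ w → ∀ i → mid w ∈ ps i → ⊥) ]′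

ColumnOf : ∀ {k m} (G : Graph k m) → (Fin k → List (Vtx k m)) → Fin (|F| G) → Set
ColumnOf G ps e = ColumnOfS G ps (splitAt (length (edges G)) e)

ColumnOfS-resp : ∀ {k m} (G : Graph k m) {ps qs} → (∀ i → ps i ≡ qs i) → ∀ s → ColumnOfS G ps s → ColumnOfS G qs s
ColumnOfS-resp G eq (inj₁ ℓ) (i , c) = i , subst (λ l → Consec l _ _) (eq i) c
ColumnOfS-resp G eq (inj₂ w) h i mem = h i (subst (mid w ∈_) (sym (eq i)) mem)

splitAt-injective : ∀ L m (e e′ : Fin (L + m)) → splitAt L e ≡ splitAt L e′ → e ≡ e′
splitAt-injective L m e e′ eq = trans (sym (join-splitAt L m e)) (trans (cong (join L m) eq) (join-splitAt L m e′))

module BaseColumns (k m : ℕ) (G : Graph k m) (acyclic : IsAcyclic G) (inS : SourcesHaveInDeg0 G) (outT : SinksHaveOutDeg0 G)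
            (b : Fin (k + m) → Fin (|F| G)) (bd : BijectiveRows k m G inS outT b) where
  open Covering k m G acyclic inS outT b bd public
  open BasePaths public

  InBase : Fin N → Set
  InBase e = Σ (Fin n) λ j → b j ≡ e

  onPath-consec : ∀ u → NotSnk u → OnPath u → Σ (Fin k) λ i → Consec (pathFrom i) u (succ u)
  onPath-consec u ns (i , p , e , w) = i , subst (λ z → Consec (pathFrom i) z (succ z)) e
      (walkFrom-consec⁺ p n (src i) (within-bound i (suc p) w′) (λ t le → w′ t (s≤s le)))
    where w′ = within-suc w (subst NotSnk (sym e) ns)

  onPath-mem : ∀ u → OnPath u → Σ (Fin k) λ i → u ∈ pathFrom i
  onPath-mem u (i , p , e , w) = i , subst (_∈ pathFrom i) e (walkFrom-∈⁺ p n (src i) (within-bound i p w) w)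

  mem-good : ∀ i u → u ∈ pathFrom i → UsesEdgeUnlessSink u
  mem-good i u mem with walkFrom-∈⁻ n (src i) u mem
  ... | t , _ , e , _ = subst UsesEdgeUnlessSink (sym e) (usesEdgeUnlessSink-seq i t)

  column⇒ColumnOf : ∀ e → InBase e → ColumnOf G pathFrom e
  column⇒ColumnOf e (j , refl) = go (splitAt L (b j)) refl
    where
    rUj : ∀ {s} → splitAt L (b j) ≡ s → rU j ≡ rowUˢ s
    rUj eq = cong rowUˢ eq
    go : ∀ s → splitAt L (b j) ≡ s → ColumnOfS G pathFrom s
    go (inj₁ ℓ) eq = proj₁ res , subst (Consec (pathFrom (proj₁ res)) (eSrc ℓ)) (UsesEdgeFacts.succ≡target ns eoU) (proj₂ res)
      where
      u = eSrc ℓ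
      ns = eSrc-ns ℓ
      cj : colU (sRow u) ≡ j
      cj = trans (cong colU (sym (rUj eq))) (colU-rU j)
      eoU : UsesEdge u
      eoU = ℓ , trans (cong (λ z → splitAt L (b z)) cj) eq
      opU : ∀ v → u ≡ v → OnPath u
      opU (src i) e′ = i , 0 , sym e′ , (λ _ ())
      opU (snk _) e′ = ⊥-elim (subst NotSnk e′ ns)
      opU (mid w) e′ = subst OnPath (sym e′) (usesEdge⇒onPath w (subst UsesEdge e′ eoU))
      res = onPath-consec u ns (opU u refl)
    go (inj₂ w) eq i mem with mem-good i (mid w) mem tt
    ... | ℓ′ , eq′ = inj₂≢inj₁ (trans (sym eq) (trans (cong (λ z → splitAt L (b z)) (sym cj)) eq′))
      where
      cj : colU (sRow (mid w)) ≡ j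
      cj = trans (cong colU (sym (rUj eq))) (colU-rU j)

  ColumnOf⇒column : ∀ e → ColumnOf G pathFrom e → InBase e
  ColumnOf⇒column e c = go (splitAt L e) refl c
    where
    go : ∀ s → splitAt L e ≡ s → ColumnOfS G pathFrom s → InBase e
    go (inj₁ ℓ) eq (i , cs) with walkFrom-consec⁻ n (src i) _ _ cs
    ... | ns , te , mem with mem-good i (eSrc ℓ) mem ns
    ...   | eo@(ℓ′ , eq′) = colU (sRow (eSrc ℓ)) , splitAt-injective L m _ _ (trans eq′ (trans (cong inj₁ ℓ′≡ℓ) (sym eq)))
      where
      ℓ′≡ℓ : ℓ′ ≡ ℓ
      ℓ′≡ℓ = lookup-injective E (unique G) (cong₂ _,_ (UsesEdgeFacts.src-eq ns eo) (trans (sym (UsesEdgeFacts.succ≡target ns eo)) (sym te)))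
    go (inj₂ w) eq notOn = colU (sRow (mid w)) , h (splitAt L (outCol (mid w))) refl
      where
      h : ∀ s′ → splitAt L (outCol (mid w)) ≡ s′ → outCol (mid w) ≡ e
      h (inj₁ ℓ′) eq′ with onPath-mem (mid w) (usesEdge⇒onPath w (ℓ′ , eq′))
      ... | i , mem = ⊥-elim (notOn i mem)
      h (inj₂ w″) eq′ = splitAt-injective L m _ _ (trans eq′ (trans (cong inj₂ w″≡) (sym eq)))
        where
        w″≡ : w″ ≡ w
        w″≡ = ↑ʳ-injective k w″ w (trans (sym (cong rowUˢ eq′)) (rowU-outCol (mid w)))

module BaseCongruence (k m : ℕ) (G : Graph k m) (inS : SourcesHaveInDeg0 G) (outT : SinksHaveOutDeg0 G)
            (b b′ : Fin (k + m) → Fin (|F| G)) (bd : BijectiveRows k m G inS outT b) (bd′ : BijectiveRows k m G inS outT b′)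
            (eqb : ∀ j → b j ≡ b′ j) where
  module X = Successor k m G inS outT b bd
  module Y = Successor k m G inS outT b′ bd′
  open Incidence k m G inS outT

  colU≡ : ∀ x → X.colU x ≡ Y.colU x
  colU≡ x = X.rUinj (trans (X.rU-colU x) (sym (trans (cong rowU (eqb (Y.colU x))) (Y.rU-colU x))))

  outCol≡ : ∀ v → X.outCol v ≡ Y.outCol v
  outCol≡ v = trans (eqb _) (cong b′ (colU≡ (sRow v)))

  succ≡ : ∀ v → X.succ v ≡ Y.succ v
  succ≡ (snk j) = refl
  succ≡ (src i) = cong (λ e → [ eTgt , (λ _ → src i) ]′ (splitAt L e)) (outCol≡ (src i))
  succ≡ (mid w) = cong (λ e → [ eTgt , (λ _ → mid w) ]′ (splitAt L e)) (outCol≡ (mid w))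

  walkFrom≡ : ∀ f v → X.walkFrom f v ≡ Y.walkFrom f v
  walkFrom≡ zero v = refl
  walkFrom≡ (suc f) (snk j) = refl
  walkFrom≡ (suc f) (src i) = cong (src i ∷_) (trans (walkFrom≡ f (X.succ (src i))) (cong (Y.walkFrom f) (succ≡ (src i))))
  walkFrom≡ (suc f) (mid w) = cong (mid w ∷_) (trans (walkFrom≡ f (X.succ (mid w))) (cong (Y.walkFrom f) (succ≡ (mid w))))

-- The common base of a system of disjoint paths

module Walks {k m : ℕ} (G : Graph k m) (outT : SinksHaveOutDeg0 G) where
  open Rows k m

  walk-head : ∀ {a z xs} → IsWalk G a z xs → Σ (List V) λ tl → xs ≡ a ∷ tl
  walk-head here = [] , refl
  walk-head (IsWalk.step {xs = xs} e w) = xs , refl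

  walk-succ : ∀ {a j xs u} → IsWalk G a (snk j) xs → u ∈ xs → NotSnk u → Σ V λ c → Consec xs u c × Edge G u c
  walk-succ here (here refl) ()
  walk-succ here (there ()) ns
  walk-succ (IsWalk.step {w = w} e rest) (here refl) ns with walk-head rest
  ... | tl , refl = w , here , e
  walk-succ (IsWalk.step e rest) (there mem) ns with walk-succ rest mem ns
  ... | c , cs , e′ = c , there cs , e′

  walk-determined : ∀ {v j j′ xs ys} (st : V → V) → IsWalk G v (snk j) xs → IsWalk G v (snk j′) ys →
            (∀ a c → Consec xs a c → c ≡ st a) → (∀ a c → Consec ys a c → c ≡ st a) → xs ≡ ys
  walk-determined st here here hx hy = refl
  walk-determined st here (IsWalk.step e _) hx hy = ⊥-elim (outT _ _ e)
  walk-determined st (IsWalk.step e _) here hx hy = ⊥-elim (outT _ _ e)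
  walk-determined {v} st (IsWalk.step {w = w1} e1 r1) (IsWalk.step {w = w2} e2 r2) hx hy with walk-head r1 | walk-head r2
  ... | t1 , refl | t2 , refl with trans (hx v w1 here) (sym (hy v w2 here))
  ... | refl = cong (v ∷_) (walk-determined st r1 r2 (λ a c cs → hx a c (there cs)) (λ a c cs → hy a c (there cs)))

-- Each vertex outside T is assigned the column of the edge leaving it along its path, or its
-- F₂-column if it lies on no path; sorting these columns gives the base.
module BaseOfPaths (k m : ℕ) (G : Graph k m) (inS : SourcesHaveInDeg0 G) (outT : SinksHaveOutDeg0 G) (P : DisjointPaths G) where
  open Incidence k m G inS outT
  open Walks G outT

  ps : Fin k → List V
  ps = path P
  walkOf : ∀ i → IsWalk G (src i) (snk (σ P ⟨$⟩ʳ i)) (ps i)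
  walkOf i = proj₁ (isPath P i)
  uniqOf : ∀ i → Unique (ps i)
  uniqOf i = proj₂ (isPath P i)

  samePath : ∀ i i′ x → x ∈ ps i → x ∈ ps i′ → i ≡ i′
  samePath i i′ x p q with i Fin.≟ i′
  ... | yes e = e
  ... | no ne = ⊥-elim (disjoint P i i′ ne x p q)

  ColumnForS : V → Fin L ⊎ Fin m → Set
  ColumnForS v (inj₁ ℓ) = eSrc ℓ ≡ v × Σ (Fin k) λ i → Consec (ps i) v (eTgt ℓ)
  ColumnForS v (inj₂ w) = v ≡ mid w × (∀ i → mid w ∈ ps i → ⊥)

  ColumnFor : V → Fin N → Set
  ColumnFor v e = ColumnForS v (splitAt L e)

  edgeIdx : ∀ {a c} → Edge G a c → Σ (Fin L) λ ℓ → eSrc ℓ ≡ a × eTgt ℓ ≡ c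
  edgeIdx p = Any.index p , cong proj₁ (sym (lookup-index p)) , cong proj₂ (sym (lookup-index p))

  edgeColumn : ∀ {v} i c → Consec (ps i) v c → Edge G v c → Σ (Fin N) (ColumnFor v)
  edgeColumn {v} i c cs e with edgeIdx e
  ... | ℓ , e1 , e2 = ℓ ↑ˡ m , subst (ColumnForS v) (sym (splitAt-↑ˡ L ℓ m)) (e1 , i , subst (Consec (ps i) v) (sym e2) cs)

  columnFor : ∀ v → NotSnk v → Σ (Fin N) (ColumnFor v)
  columnFor (src i) _ with walk-succ (walkOf i) (subst (src i ∈_) (sym (proj₂ (walk-head (walkOf i)))) (here refl)) tt
  ... | c , cs , e = edgeColumn i c cs e
  columnFor (mid w) _ with any? (λ i → mid w ∈? ps i)
    where open import Data.List.Membership.DecPropositional _≟V_ using (_∈?_)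
  ... | yes (i , mem) with walk-succ (walkOf i) mem tt
  ...   | c , cs , e = edgeColumn i c cs e
  columnFor (mid w) _ | no ¬p = L ↑ʳ w , subst (ColumnForS (mid w)) (sym (splitAt-↑ʳ L m w)) (refl , (λ i mem → ¬p (i , mem)))

  columnOf : Fin n → Fin N
  columnOf x = proj₁ (columnFor (vtxOf x) (ns-vtxOf x))
  columnOf-for : ∀ x → ColumnFor (vtxOf x) (columnOf x)
  columnOf-for x = proj₂ (columnFor (vtxOf x) (ns-vtxOf x))

  rowU-ColumnFor : ∀ v e → ColumnFor v e → rowU e ≡ sRow v
  rowU-ColumnFor v e ok = h (splitAt L e) refl (subst (ColumnForS v) refl ok)
    where
    h : ∀ s → splitAt L e ≡ s → ColumnForS v s → rowU e ≡ sRow v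
    h (inj₁ ℓ) eq (e1 , _) = trans (cong rowUˢ eq) (cong sRow e1)
    h (inj₂ w) eq (e1 , _) = trans (cong rowUˢ eq) (cong sRow (sym e1))

  rowU-columnOf : ∀ x → rowU (columnOf x) ≡ x
  rowU-columnOf x = trans (rowU-ColumnFor (vtxOf x) (columnOf x) (columnOf-for x)) (sRow-vtxOf x)

  columnOf-injective : Injective _≡_ _≡_ columnOf
  columnOf-injective {x} {y} e = trans (sym (rowU-columnOf x)) (trans (cong rowU e) (rowU-columnOf y))

  rowV-ColumnFor-injective : ∀ v v′ e e′ → ColumnFor v e → ColumnFor v′ e′ → rowV e ≡ rowV e′ → v ≡ v′
  rowV-ColumnFor-injective v v′ e e′ ok ok′ eqV = h (splitAt L e) (splitAt L e′) refl refl ok ok′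
    where
    rv : ∀ {x} s → splitAt L x ≡ s → rowV x ≡ rowVˢ s
    rv s eq = cong rowVˢ eq
    h : ∀ s s′ → splitAt L e ≡ s → splitAt L e′ ≡ s′ → ColumnForS v (splitAt L e) → ColumnForS v′ (splitAt L e′) → v ≡ v′
    h s s′ eq eq′ ok ok′ = by-cases s s′ (trans (sym (rv s eq)) (trans eqV (rv s′ eq′))) (subst (ColumnForS v) eq ok) (subst (ColumnForS v′) eq′ ok′)
      where
      by-cases : ∀ s s′ → rowVˢ s ≡ rowVˢ s′ → ColumnForS v s → ColumnForS v′ s′ → v ≡ v′
      by-cases (inj₁ ℓ) (inj₁ ℓ′) t (_ , i , cs) (_ , i′ , cs′) = consec-unique-left (uniqOf i) cs (subst (λ z → Consec (ps z) v′ (eTgt ℓ)) (sym ii) cs″)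
        where
        tt≡ : eTgt ℓ′ ≡ eTgt ℓ
        tt≡ = tRow-inj (eTgt-ns ℓ′) (eTgt-ns ℓ) (sym t)
        cs″ : Consec (ps i′) v′ (eTgt ℓ)
        cs″ = subst (Consec (ps i′) v′) tt≡ cs′
        ii : i ≡ i′
        ii = samePath i i′ (eTgt ℓ) (consec-mem₂ cs) (consec-mem₂ cs″)
      by-cases (inj₁ ℓ) (inj₂ w′) t (_ , i , cs) (_ , notOn) = ⊥-elim (notOn i (subst (_∈ ps i) (tRow-inj (eTgt-ns ℓ) tt t) (consec-mem₂ cs)))
      by-cases (inj₂ w) (inj₁ ℓ′) t (_ , notOn) (_ , i′ , cs′) = ⊥-elim (notOn i′ (subst (_∈ ps i′) (tRow-inj (eTgt-ns ℓ′) tt (sym t)) (consec-mem₂ cs′)))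
      by-cases (inj₂ w) (inj₂ w′) t (e1 , _) (e2 , _) = trans e1 (trans (cong mid (↑ʳ-injective k w w′ t)) (sym e2))

  open Sort columnOf columnOf-injective public

  b : Fin n → Fin N
  b = sorted

  rowU-b : ∀ j → rowU (b j) ≡ rinv j
  rowU-b j = rowU-columnOf (rinv j)

  rU-inj : Injective _≡_ _≡_ (λ j → rowU (b j))
  rU-inj {x} {y} e = rinv-inj (trans (sym (rowU-b x)) (trans e (rowU-b y)))

  rV-inj : Injective _≡_ _≡_ (λ j → rowV (b j))
  rV-inj {x} {y} e = rinv-inj (trans (sym (sRow-vtxOf (rinv x)))
      (trans (cong sRow (rowV-ColumnFor-injective _ _ _ _ (columnOf-for (rinv x)) (columnOf-for (rinv y)) e)) (sRow-vtxOf (rinv y))))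

  ±1-sₑ : ∀ e → ±1 (sₑ G e)
  ±1-sₑ e with splitAt L e
  ... | inj₁ _ = inj₂ refl
  ... | inj₂ _ = inj₁ refl

  nz₁ : det n (sub (A⃗₁ G) b) ≢ 0ℚ
  nz₁ = ±1⇒≢0 (subst ±1 (sym (trans (det-cong n (λ x j → A⃗₁-column x (b j))) (det-monomial n _ (λ j → sₑ G (b j)) rU-inj)))
           (±1-* (±1-sgnℕ (inversions n (λ j → rowU (b j)))) (±1-Πq n _ (λ j → ±1-sₑ (b j)))))

  nz₂ : det n (sub (A⃗₂ G) b) ≢ 0ℚ
  nz₂ = ±1⇒≢0 (subst ±1 (sym (trans (det-cong n (λ x j → A⃗₂-column x (b j))) (det-monomial n _ (λ _ → 1ℚ) rV-inj)))
           (±1-* (±1-sgnℕ (inversions n (λ j → rowV (b j)))) (±1-Πq n _ (λ j → inj₁ refl))))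

  base : CommonBase G
  base = record { cols = b ; strict = sorted-sinc ; nonsing₁ = nz₁ ; nonsing₂ = nz₂ }

  bd : BijectiveRows k m G inS outT b
  bd = bijectiveRows k m G inS outT b nz₁ nz₂

  module B = Successor k m G inS outT b bd

  consec-edge : ∀ {a z xs u c} → IsWalk G a z xs → Consec xs u c → Edge G u c
  consec-edge (IsWalk.step e rest) cs with walk-head rest
  consec-edge (IsWalk.step e rest) here | tl , refl = e
  consec-edge (IsWalk.step e rest) (there cs) | tl , refl = consec-edge rest cs
  consec-edge here (there ())

  outCol≡ : ∀ a → B.outCol a ≡ columnOf (sRow a)
  outCol≡ a = cong columnOf (trans (sym (rowU-columnOf (rinv (B.colU (sRow a))))) (B.rowU-outCol a))

  succ-consec : ∀ a c i → Consec (ps i) a c → B.succ a ≡ c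
  succ-consec a c i cs = trans (B.succ-notSink a nsa) (trans (cong (B.succVia a) (outCol≡ a)) (h (splitAt L (columnOf (sRow a))) refl))
    where
    nsa′ : ∀ u → Edge G u c → NotSnk u
    nsa′ (src _) _ = tt
    nsa′ (mid _) _ = tt
    nsa′ (snk j) e = outT j c e
    nsa : NotSnk a
    nsa = nsa′ a (consec-edge (walkOf i) cs)
    ok : ColumnFor a (columnOf (sRow a))
    ok = subst (λ z → ColumnFor z (columnOf (sRow a))) (vtxOf-sRow a nsa) (columnOf-for (sRow a))
    h : ∀ s → splitAt L (columnOf (sRow a)) ≡ s → B.succVia a (columnOf (sRow a)) ≡ c
    h (inj₁ ℓ) eq with subst (ColumnForS a) eq ok
    ... | _ , i′ , cs′ = trans (cong [ eTgt , (λ _ → a) ]′ eq)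
          (consec-unique-right (uniqOf i) (subst (λ z → Consec (ps z) a (eTgt ℓ)) (samePath i′ i a (consec-mem₁ cs′) (consec-mem₁ cs)) cs′) cs)
    h (inj₂ w) eq with subst (ColumnForS a) eq ok
    ... | e1 , notOn = ⊥-elim (notOn i (subst (_∈ ps i) e1 (consec-mem₁ cs)))

  paths≡ : ∀ i → B.BasePaths.pathFrom i ≡ ps i
  paths≡ i = walk-determined B.succ (B.BasePaths.pathFrom-isWalk i) (walkOf i)
     (λ a c cs → proj₁ (proj₂ (B.walkFrom-consec⁻ n (src i) a c cs))) (λ a c cs → sym (succ-consec a c i cs))

-- The correspondence and the Pfaffian property

anyMap? : ∀ r M (P : (Fin r → Fin M) → Set) → (∀ f g → (∀ i → f i ≡ g i) → P f → P g) → (∀ f → Dec (P f)) →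
        Dec (Σ (Fin r → Fin M) P)
anyMap? zero M P resp P? with P? (λ ())
... | yes p = yes ((λ ()) , p)
... | no ¬p = no (λ { (f , pf) → ¬p (resp f (λ ()) (λ ()) pf) })
anyMap? (suc r) M P resp P? with any? (λ a → anyMap? r M (λ h → P (a Vector.∷ h))
                                        (λ f g eq → resp (a Vector.∷ f) (a Vector.∷ g) (λ { zero → refl ; (suc i) → eq i }))
                                        (λ h → P? (a Vector.∷ h)))
... | yes (a , h , p) = yes (a Vector.∷ h , p)
... | no ¬ex = no (λ { (f , pf) → ¬ex (f zero , (λ i → f (suc i)) , resp f _ (λ { zero → refl ; (suc i) → refl }) pf) })

module Correspondence {k m : ℕ} (G : Graph k m) (acyclic : IsAcyclic G)
                      (inS : SourcesHaveInDeg0 G) (outT : SinksHaveOutDeg0 G) where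
  private
    n = k + m

  bijectiveRowsOf : (B : CommonBase G) → BijectiveRows k m G inS outT (cols B)
  bijectiveRowsOf B = bijectiveRows k m G inS outT (cols B) (nonsing₁ B) (nonsing₂ B)

  pathsOf : CommonBase G → DisjointPaths G
  pathsOf B = Successor.BasePaths.paths k m G inS outT (cols B) (bijectiveRowsOf B)

  pathsOf-cong : ∀ B B′ → B ≈B B′ → pathsOf B ≈P pathsOf B′
  pathsOf-cong B B′ B≈B′ i =
    BaseCongruence.walkFrom≡ k m G inS outT (cols B) (cols B′) (bijectiveRowsOf B) (bijectiveRowsOf B′) B≈B′ n (src i)

  pathsOf-injective : ∀ B B′ → pathsOf B ≈P pathsOf B′ → B ≈B B′
  pathsOf-injective B B′ P≈P′ = strict-unique (cols B) (cols B′) (strict B) (strict B′) B⊆B′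
    where
    module C = BaseColumns k m G acyclic inS outT (cols B) (bijectiveRowsOf B)
    module C′ = BaseColumns k m G acyclic inS outT (cols B′) (bijectiveRowsOf B′)
    B⊆B′ : ∀ j → ∃ λ j′ → cols B j ≡ cols B′ j′
    B⊆B′ j with C′.ColumnOf⇒column (cols B j)
                  (ColumnOfS-resp G P≈P′ (splitAt (length (edges G)) (cols B j)) (C.column⇒ColumnOf (cols B j) (j , refl)))
    ... | j′ , e = j′ , sym e

  pathsOf-surjective : ∀ P → Σ (CommonBase G) (λ B → pathsOf B ≈P P)
  pathsOf-surjective P = BaseOfPaths.base k m G inS outT P , BaseOfPaths.paths≡ k m G inS outT P

  det*det≡sgnP : ∀ B → det n (sub (A⃗₁ G) (cols B)) * det n (sub (A⃗₂ G) (cols B)) ≡ sgnℕ k * sgnP (pathsOf B)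
  det*det≡sgnP B = BaseSign.det*det≡sign k m G acyclic inS outT (cols B) (bijectiveRowsOf B)

  IsCommonBase : (Fin n → Fin (|F| G)) → Set
  IsCommonBase b = StrictlyIncreasing b × det n (sub (A⃗₁ G) b) ≢ 0ℚ × det n (sub (A⃗₂ G) b) ≢ 0ℚ

  IsCommonBase-resp : ∀ b b′ → (∀ i → b i ≡ b′ i) → IsCommonBase b → IsCommonBase b′
  IsCommonBase-resp b b′ eq (strict , nz₁ , nz₂) =
    (λ i j lt → subst₂ Fin._<_ (eq i) (eq j) (strict i j lt)) ,
    (λ e → nz₁ (trans (det-cong n (λ x j → cong (A⃗₁ G x) (eq j))) e)) ,
    (λ e → nz₂ (trans (det-cong n (λ x j → cong (A⃗₂ G x) (eq j))) e))

  isCommonBase? : ∀ b → Dec (IsCommonBase b)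
  isCommonBase? b = FinP.all? (λ i → FinP.all? (λ j → (i FinP.<? j) →-dec (b i FinP.<? b j)))
                    ×-dec ¬? (det n (sub (A⃗₁ G) b) ℚP.≟ 0ℚ) ×-dec ¬? (det n (sub (A⃗₂ G) b) ℚP.≟ 0ℚ)

  commonBase? : Dec (CommonBase G)
  commonBase? with anyMap? n (|F| G) IsCommonBase IsCommonBase-resp isCommonBase?
  ... | yes (b , strict , nz₁ , nz₂) = yes (record { cols = b ; strict = strict ; nonsing₁ = nz₁ ; nonsing₂ = nz₂ })
  ... | no none = no (λ B → none (cols B , strict B , nonsing₁ B , nonsing₂ B))

  pfaffian : LGVPosition G → Σ ℚ (λ c → IsPfaffianPair G c × ±1 c)
  pfaffian lgv with commonBase?
  -- Without common bases the condition is vacuous; any constant ±1 will do.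
  ... | no none = 1ℚ , ((λ ()) , (λ B → ⊥-elim (none B))) , inj₁ refl
  ... | yes B₀ = c , (±1⇒≢0 ±1-c , constant) , ±1-c
    where
    c = det n (sub (A⃗₁ G) (cols B₀)) * det n (sub (A⃗₂ G) (cols B₀))
    ±1-c : ±1 c
    ±1-c = subst ±1 (sym (det*det≡sgnP B₀)) (±1-* (±1-sgnℕ k) (±1-sgnℕ (inversions k (σ (pathsOf B₀) ⟨$⟩ʳ_))))
    constant : ∀ B → det n (sub (A⃗₁ G) (cols B)) * det n (sub (A⃗₂ G) (cols B)) ≡ c
    constant B = trans (det*det≡sgnP B) (trans (cong (sgnℕ k *_) (lgv (pathsOf B) (pathsOf B₀))) (sym (det*det≡sgnP B₀)))

theorem4p4 : ∀ (k m : ℕ) (G : Graph k m) →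
    IsAcyclic G → SourcesHaveInDeg0 G → SinksHaveOutDeg0 G →
    Σ (CommonBase G → DisjointPaths G) (λ φ →
        (∀ B B′ → B ≈B B′ → φ B ≈P φ B′) ×
        (∀ B B′ → φ B ≈P φ B′ → B ≈B B′) ×
        (∀ P → Σ (CommonBase G) (λ B → φ B ≈P P)))
    × (LGVPosition G →
        Σ ℚ (λ c → IsPfaffianPair G c × (c ≡ 1ℚ ⊎ c ≡ - 1ℚ)))
theorem4p4 k m G acyclic inS outT =
  (pathsOf , pathsOf-cong , pathsOf-injective , pathsOf-surjective) , pfaffian
  where open Correspondence G acyclic inS outT
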